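{- Let $d\ge1$ and $n\ge 0$ with $d$ dividing $n$, and let $\mu$ be the Möbius function of $\Omega_n^{(d)}$. Then: (a) For ordered set partitions $\psi\le\omega$ in $\Omega_n^{(d)}$ (both different from $\hat0$), $\mu(\psi,\omega)=(-1)^{\operatorname{rk}(\psi,\omega)}$. (b) $\mu(\Omega_n^{(d)}):=\mu(\hat0,\hat1)=\mathcal{E}_n^{(d)}$. (c) For an ordered set partition $\omega=(B_1,\ldots,B_k)$ in $\Omega_n^{(d)}$ with $\#B_i=\alpha_i$, $\mu(\hat0,\omega)=(-1)^{k-1}\prod_{i=1}^k\mathcal{E}^{(d)}_{\alpha_i}$.
   Context: $[n]=\{1,\ldots,n\}$. An ordered set partition of $[n]$ is a sequence $(B_1,\ldots,B_k)$ of nonempty pairwise disjoint sets (blocks) with union $[n]$; it is $d$-divisible if every block has size divisible by $d$. The $d$-divisible ordered set partitions of $[n]$ are ordered by: $(B_1,\ldots,B_k)$ is covered by each $(B_1,\ldots,B_{i-1},B_i\cup B_{i+1},B_{i+2},\ldots,B_k)$, extended transitively; $\Omega_n^{(d)}$ is this poset with a unique minimum $\hat0$ adjoined. It has maximum $\hat1=([n])$ and is ranked; $\operatorname{rk}(\psi,\omega)=\operatorname{rk}\omega-\operatorname{rk}\psi$. The $d$-divisible Euler numbers $\mathcal{E}_n^{(d)}$ are defined by $\sum_{n\ge0}\mathcal{E}_n^{(d)}x^n/n! = 1/(1+x^d/d!+x^{2d}/(2d)!+\cdots)$. -}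

module Defs where

open import Data.Nat as ℕ using (ℕ; zero; suc; _<_; _∸_; NonZero; _!)
open import Data.Nat.Properties using (_!≢0)
open import Data.Nat.Divisibility using (_∣_; _∣?_)
open import Data.Integer as ℤ using (ℤ)
open import Data.Rational as ℚ using (ℚ; 0ℚ; 1ℚ)
open import Data.Bool using (Bool)
open import Data.Vec using (Vec)
open import Data.Fin.Subset using (Subset; ⊤; ⊥; _∪_; _∩_; ∣_∣)
open import Data.List as List using (List; []; _∷_; _++_; length; map; zipWith; foldr; upTo)
open import Data.List.Relation.Unary.All using (All)
open import Data.List.Relation.Unary.AllPairs using (AllPairs)
open import Data.List.Relation.Unary.Unique.Propositional using (Unique)
open import Data.List.Membership.Propositional using (_∈_)
open import Data.Maybe using (Maybe; just; nothing)
open import Data.Product using (_×_; Σ; ∃; ∃-syntax; _,_)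
open import Relation.Binary.PropositionalEquality using (_≡_; _≢_)
open import Relation.Binary.Construct.Closure.ReflexiveTransitive using (Star)
open import Relation.Nullary using (yes; no)
open import Function.Bundles using (_⇔_)

-- d-divisible ordered set partitions of [n]
-- A block is a subset of [n] = Fin n (a Vec Bool n); an ordered set
-- partition is a list of blocks (B₁,…,Bₖ) that are nonempty, pairwise
-- disjoint, with union [n]; d-divisible: d ∣ #Bᵢ for all i.

IsDivOSP : (n d : ℕ) → List (Subset n) → Set
IsDivOSP n d bs =
  All (λ b → (0 < ∣ b ∣) × (d ∣ ∣ b ∣)) bs
  × AllPairs (λ b c → b ∩ c ≡ ⊥) bs
  × foldr _∪_ ⊥ bs ≡ ⊤

-- the validity proof is irrelevant, so equality of ordered set
-- partitions is equality of their block lists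
record OSP (n d : ℕ) : Set where
  constructor osp
  field
    blocks : List (Subset n)
    .valid : IsDivOSP n d blocks
open OSP public

nblocks : ∀ {n d} → OSP n d → ℕ
nblocks ω = length (blocks ω)

_⋖_ : ∀ {n d} → OSP n d → OSP n d → Set
_⋖_ {n} ψ ω = ∃[ pre ] ∃[ b₁ ] ∃[ b₂ ] ∃[ suf ]
  (blocks ψ ≡ pre ++ b₁ ∷ b₂ ∷ suf) × (blocks ω ≡ pre ++ (b₁ ∪ b₂) ∷ suf)

_≤P_ : ∀ {n d} → OSP n d → OSP n d → Set
_≤P_ = Star _⋖_

-- Ω_n^(d): ordered set partitions with a new minimum 0̂ = nothing adjoined

Ω : ℕ → ℕ → Set
Ω n d = Maybe (OSP n d)

0̂ : ∀ {n d} → Ω n d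
0̂ = nothing

data _≤Ω_ {n d : ℕ} : Ω n d → Ω n d → Set where
  0̂≤ : ∀ {x} → nothing ≤Ω x
  ≤-just : ∀ {ψ ω} → ψ ≤P ω → just ψ ≤Ω just ω

_<Ω_ : ∀ {n d} → Ω n d → Ω n d → Set
x <Ω y = (x ≤Ω y) × (x ≢ y)

1̂ : ∀ n d → 0 < n → d ∣ n → Ω n d
1̂ n d 0<n d∣n = just (osp (⊤ ∷ []) (valid1 n d 0<n d∣n))
  where
  open import Data.List.Relation.Unary.All using ([]; _∷_)
  open import Data.List.Relation.Unary.AllPairs using ([]; _∷_)
  open import Data.Fin.Subset.Properties using (∣⊤∣≡n; ∪-identityʳ)
  open import Relation.Binary.PropositionalEquality using (subst; sym)
  valid1 : ∀ n d → 0 < n → d ∣ n → IsDivOSP n d (⊤ ∷ [])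
  valid1 n d p q =
    ( (subst (0 <_) (sym (∣⊤∣≡n n)) p , subst (d ∣_) (sym (∣⊤∣≡n n)) q) ∷ [])
    , ([] ∷ [])
    , ∪-identityʳ ⊤

-- rank: rk 0̂ = 0, and an ordered set partition with k blocks has rank
-- n/d + 1 − k (the atoms are the partitions into n/d blocks of size d)
rk : ∀ {n d} .{{_ : NonZero d}} → Ω n d → ℕ
rk nothing = 0
rk {n} {d} (just ω) = suc (n ℕ./ d) ∸ nblocks ω

rkI : ∀ {n d} .{{_ : NonZero d}} → Ω n d → Ω n d → ℕ
rkI ψ ω = rk ω ∸ rk ψ

-- Möbius function of a finite poset, characterised by its defining
-- recursion: μ(x,x) = 1 and Σ_{x ≤ z ≤ y} μ(x,z) = 0 for x < y, where the
-- sum ranges over any duplicate-free list enumerating the interval [x,y].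

IsMobius : ∀ {n d} → (Ω n d → Ω n d → ℤ) → Set
IsMobius {n} {d} μ =
  (∀ x → μ x x ≡ ℤ.+ 1)
  × (∀ x y → x <Ω y → (zs : List (Ω n d)) → Unique zs
      → (∀ z → (z ∈ zs) ⇔ ((x ≤Ω z) × (z ≤Ω y)))
      → List.foldr ℤ._+_ (ℤ.+ 0) (map (μ x) zs) ≡ ℤ.+ 0)

-- d-divisible Euler numbers: Σ E_n xⁿ/n! = 1 / (Σ_{j≥0} x^{jd}/(jd)!)

-- coefficient of xᵐ in f(x) = 1 + x^d/d! + x^{2d}/(2d)! + ⋯
fcoeff : ℕ → ℕ → ℚ
fcoeff d m with d ∣? m
... | yes _ = ℚ._/_ (ℤ.+ 1) (m !) {{m !≢0}}
... | no _  = 0ℚ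

-- coefficients of g = 1/f, as the reversed list [gₙ, gₙ₋₁, …, g₀]
-- (g₀ = 1, gₙ = − Σ_{m=1}^{n} fₘ gₙ₋ₘ, since f₀ = 1)
invCoeffs : ℕ → ℕ → List ℚ
invCoeffs d zero = 1ℚ ∷ []
invCoeffs d (suc n) =
  ℚ.-_ (foldr ℚ._+_ 0ℚ
         (zipWith ℚ._*_ (map (λ i → fcoeff d (suc i)) (upTo (suc n)))
                        (invCoeffs d n)))
  ∷ invCoeffs d n

head0 : List ℚ → ℚ
head0 [] = 0ℚ
head0 (x ∷ _) = x

𝓔 : ℕ → ℕ → ℚ
𝓔 d n = ℚ._*_ (ℚ._/_ (ℤ.+ (n !)) 1) (head0 (invCoeffs d n))

toℚ : ℤ → ℚ
toℚ z = ℚ._/_ z 1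

prodℚ : List ℚ → ℚ
prodℚ = foldr ℚ._*_ 1ℚ

-- The Möbius recursion determines μ(x, y) by induction on the rank of y, so each formula only
-- has to sum to 0 over some enumeration of every interval [x, y] with x < y.
-- Above ψ = (B₁, …, Bₖ), an element of [ψ, ω] is fixed by choosing which of the gaps of ψ that
-- are closed in ω to close, so [ψ, ω] is a Boolean lattice and the signs (-1)^rk cancel.
-- Below ω, a refinement is built by choosing its first block V ⊆ B₁ (nonempty, d ∣ #V) and
-- refining B₁ ∖ V, B₂, …, Bₖ. Summing -(-1)^k ∏ E_{#Cᵢ} over the refinements block by block
-- reduces to Σ_{V ⊆ B, 0 < #V, d ∣ #V} E_{#V} = -1 for d ∣ #B > 0, which is the coefficient
-- of x^{#B}/#B! in (Σ_j x^{jd}/(jd)!) · (Σ_m E_m x^m/m!) = 1. Part (b) is part (c) for ω = ([n]).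

module Submission where

module OrderedSetPartitionPoset where
  open import Data.Bool as Bool using (Bool; true; false; if_then_else_)
  open import Data.Empty using (⊥-elim)
  open import Data.Fin.Subset using (Subset; ⊤; ⊥; _∪_; _∩_; _─_; ∣_∣; _⊆_; _∈_; inside; outside)
  open import Data.Fin.Subset.Properties
    using (∩-comm; ∩-distribˡ-∪; ∩-zeroʳ; ∪-identityʳ; ∪-assoc; ⊆-refl; ⊆-antisym; ⊆-min; p⊆p∪q; q⊆p∪q;
           x∈p∩q⁺; x∈p∩q⁻; drop-∷-⊆; out⊆; s⊆s; p─q⊆p; ∣⊤∣≡n; ∣⊥∣≡0)
  open import Data.Integer as ℤ using (ℤ; +_; -_; _+_; _-_; _*_; _^_; -1ℤ)
  import Data.Integer.Properties as ℤ
  open import Data.Integer.Tactic.RingSolver using (solve-∀)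
  open import Data.List as List
    using (List; []; _∷_; [_]; _++_; map; concatMap; filter; foldr; length;
           applyUpTo; upTo; downFrom; zipWith)
  import Data.List.Properties as List
  open import Data.List.Membership.Propositional as Mem using () renaming (_∈_ to _∈ₗ_)
  open import Data.List.Membership.Propositional.Properties
    using (map∷⁻; ∈-map⁺; ∈-map⁻; ∈-++⁺ˡ; ∈-++⁺ʳ; ∈-++⁻; ∈-concatMap⁺; ∈-concatMap⁻; ∈-filter⁺; ∈-filter⁻)
  open import Data.List.Relation.Unary.All as All using (All; []; _∷_; all?)
  open import Data.List.Relation.Unary.All.Properties using () renaming (map⁺ to All-map⁺)
  open import Data.List.Relation.Unary.AllPairs using (AllPairs; []; _∷_; allPairs?)
  open import Data.List.Relation.Unary.Any using (here; there)
  open import Data.List.Relation.Unary.Unique.Propositional using (Unique)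
  import Data.List.Relation.Unary.Unique.Propositional.Properties as Unique
  open import Data.Maybe using (just; nothing; fromMaybe)
  import Data.Maybe.Properties as Maybe
  open import Data.Nat as ℕ using (ℕ; zero; suc; _<_; _≤_; _∸_; z≤n; s≤s; _!; NonZero)
  open import Data.Nat.Combinatorics using (_C_; nCk+nC[k+1]≡[n+1]C[k+1]; k>n⇒nCk≡0; k![n∸k]!∣n!)
  open import Data.Nat.Combinatorics.Specification using (nCk≡n!/k![n-k]!)
  open import Data.Nat.Divisibility using (_∣_; _∣?_; _∣0; ∣m+n∣m⇒∣n; ∣m∣n⇒∣m+n; ∣⇒≤)
  open import Data.Nat.DivMod using (_/_; m/n*n≡m; m*n/n≡m; m/n≤m; /-monoˡ-≤)
  open import Data.Nat.Induction using (<-wellFounded)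
  open import Data.Nat.ListAction using (sum)
  open import Data.Nat.Properties using (_!≢0; _!*_!≢0)
  import Data.Nat.Properties as ℕ
  open import Data.Product using (_×_; _,_; proj₁; proj₂; ∃; ∃-syntax)
  open import Data.Rational as ℚ using (ℚ; 0ℚ; 1ℚ)
  import Data.Rational.Properties as ℚ
  open import Data.Rational.Solver using (module +-*-Solver)
  open import Data.Rational.Unnormalised as ℚᵘ using (mkℚᵘ; *≡*)
  import Data.Rational.Unnormalised.Properties as ℚᵘ
  open import Data.Sum using (_⊎_; inj₁; inj₂)
  open import Data.Vec using ([]; _∷_; here; there)
  import Data.Vec.Properties as Vec
  open import Function using (_∘_)
  open import Function.Bundles using (_⇔_; mk⇔; Equivalence)
  import Induction.WellFounded as WF
  open import Level using (Level)
  open import Relation.Binary.Construct.Closure.ReflexiveTransitive using (Star; ε; _◅_; _◅◅_)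
  import Relation.Binary.Construct.On as On
  open import Relation.Binary.Definitions using (DecidableEquality)
  open import Relation.Binary.PropositionalEquality hiding ([_])
  open import Relation.Nullary using (Dec; yes; no; does; ¬_)
  open import Relation.Nullary.Decidable using (_×-dec_; recompute)
  open import Relation.Unary using (Pred; Decidable)
  open import Algebra.Properties.AbelianGroup ℤ.+-0-abelianGroup using (∙-cancelˡ; ∙-cancelʳ)
  open import Algebra.Properties.CommutativeSemigroup ℤ.+-commutativeSemigroup
    using () renaming (interchange to +-interchange)
  open import Defs

  private
    variable
      a b : Level
      A : Set a
      B : Set b
      n : ℕ

  sumℤ : List ℤ → ℤ
  sumℤ = foldr _+_ (+ 0)

  sum-++ : (xs ys : List ℤ) → sumℤ (xs ++ ys) ≡ sumℤ xs + sumℤ ys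
  sum-++ []       ys = sym (ℤ.+-identityˡ _)
  sum-++ (x ∷ xs) ys = trans (cong (_+_ x) (sum-++ xs ys)) (sym (ℤ.+-assoc x _ _))

  sum-map-++ : (f : A → ℤ) (xs ys : List A) →
               sumℤ (map f (xs ++ ys)) ≡ sumℤ (map f xs) + sumℤ (map f ys)
  sum-map-++ f xs ys = trans (cong sumℤ (List.map-++ f xs ys)) (sum-++ (map f xs) (map f ys))

  sum-cong : {xs : List A} {f g : A → ℤ} → (∀ {x} → x ∈ₗ xs → f x ≡ g x) →
             sumℤ (map f xs) ≡ sumℤ (map g xs)
  sum-cong {xs = []}     f≗g = refl
  sum-cong {xs = x ∷ xs} f≗g = cong₂ _+_ (f≗g (here refl)) (sum-cong (f≗g ∘ there))

  sum-*ˡ : (c : ℤ) (f : A → ℤ) (xs : List A) →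
           sumℤ (map (λ x → c * f x) xs) ≡ c * sumℤ (map f xs)
  sum-*ˡ c f []       = sym (ℤ.*-zeroʳ c)
  sum-*ˡ c f (x ∷ xs) = trans (cong (_+_ (c * f x)) (sum-*ˡ c f xs)) (sym (ℤ.*-distribˡ-+ c (f x) _))

  sum-concatMap : (g : A → List B) (f : B → ℤ) (xs : List A) →
                  sumℤ (map f (concatMap g xs)) ≡ sumℤ (map (λ x → sumℤ (map f (g x))) xs)
  sum-concatMap g f []       = refl
  sum-concatMap g f (x ∷ xs) =
    trans (sum-map-++ f (g x) (concatMap g xs)) (cong (_+_ (sumℤ (map f (g x)))) (sum-concatMap g f xs))

  sum-filter : {P : Pred A b} (P? : Decidable P) (f : A → ℤ) (xs : List A) →
               sumℤ (map f (filter P? xs)) ≡ sumℤ (map (λ x → if does (P? x) then f x else + 0) xs)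
  sum-filter P? f []       = refl
  sum-filter P? f (x ∷ xs) with P? x
  ... | yes _ = cong (_+_ (f x)) (sum-filter P? f xs)
  ... | no  _ = trans (sum-filter P? f xs) (sym (ℤ.+-identityˡ _))

  productℤ : List ℤ → ℤ
  productℤ = foldr _*_ (+ 1)

  sum-determines-point : {xs : List A} {y : A} (f g : A → ℤ) → Unique xs → y ∈ₗ xs →
                         (∀ {z} → z ∈ₗ xs → z ≢ y → f z ≡ g z) →
                         sumℤ (map f xs) ≡ sumℤ (map g xs) → f y ≡ g y
  sum-determines-point {xs = y ∷ xs} f g (y∉xs ∷ _) (here refl) agree Σf≡Σg =
    ∙-cancelʳ _ _ _ (trans Σf≡Σg (cong (_+_ (g y)) (sym (sum-cong rest))))
    where
    rest : ∀ {z} → z ∈ₗ xs → f z ≡ g z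
    rest z∈xs = agree (there z∈xs) (λ z≡y → All.lookup y∉xs z∈xs (sym z≡y))
  sum-determines-point {xs = x ∷ xs} f g (x∉xs ∷ xs-unique) (there y∈xs) agree Σf≡Σg =
    sum-determines-point f g xs-unique y∈xs (agree ∘ there)
      (∙-cancelˡ (g x) _ _ (trans (cong (_+ sumℤ (map f xs)) (sym fx≡gx)) Σf≡Σg))
    where
    fx≡gx : f x ≡ g x
    fx≡gx = agree (here refl) (λ x≡y → All.lookup x∉xs y∈xs x≡y)

  unique-map⁺ : {xs : List A} (f : A → B) →
                (∀ {x y} → x ∈ₗ xs → y ∈ₗ xs → f x ≡ f y → x ≡ y) →
                Unique xs → Unique (map f xs)
  unique-map⁺ f inj []             = []
  unique-map⁺ f inj (x∉xs ∷ xs-u) =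
    All-map⁺ (All.tabulate (λ y∈xs fx≡fy → All.lookup x∉xs y∈xs (inj (here refl) (there y∈xs) fx≡fy)))
    ∷ unique-map⁺ f (λ x∈ y∈ → inj (there x∈) (there y∈)) xs-u

  unique-concatMap : {xs : List A} (f : A → List B) → Unique xs → (∀ {x} → x ∈ₗ xs → Unique (f x)) →
                     (∀ {x y z} → x ∈ₗ xs → y ∈ₗ xs → z ∈ₗ f x → z ∈ₗ f y → x ≡ y) →
                     Unique (concatMap f xs)
  unique-concatMap {xs = []}     f _             _        _        = []
  unique-concatMap {xs = x ∷ xs} f (x∉xs ∷ xs-u) f-unique f-apart =
    Unique.++⁺ (f-unique (here refl))
      (unique-concatMap f xs-u (f-unique ∘ there) (λ x∈ y∈ → f-apart (there x∈) (there y∈)))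
      λ (z∈fx , z∈rest) → let (y , y∈xs , z∈fy) = Mem.find (∈-concatMap⁻ f z∈rest)
                          in All.lookup x∉xs y∈xs (f-apart (here refl) (there y∈xs) z∈fx z∈fy)

  Disjoint : Subset n → Subset n → Set
  Disjoint p q = p ∩ q ≡ ⊥

  ∣p∪q∣≡∣p∣+∣q∣ : (p q : Subset n) → Disjoint p q → ∣ p ∪ q ∣ ≡ ∣ p ∣ ℕ.+ ∣ q ∣
  ∣p∪q∣≡∣p∣+∣q∣ []            []            _  = refl
  ∣p∪q∣≡∣p∣+∣q∣ (true  ∷ p)  (false ∷ q)  pq = cong suc (∣p∪q∣≡∣p∣+∣q∣ p q (Vec.∷-injectiveʳ pq))
  ∣p∪q∣≡∣p∣+∣q∣ (false ∷ p)  (true  ∷ q)  pq =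
    trans (cong suc (∣p∪q∣≡∣p∣+∣q∣ p q (Vec.∷-injectiveʳ pq))) (sym (ℕ.+-suc ∣ p ∣ ∣ q ∣))
  ∣p∪q∣≡∣p∣+∣q∣ (false ∷ p)  (false ∷ q)  pq = ∣p∪q∣≡∣p∣+∣q∣ p q (Vec.∷-injectiveʳ pq)

  disjoint-sym : {p q : Subset n} → Disjoint p q → Disjoint q p
  disjoint-sym {p = p} {q} pq = trans (∩-comm q p) pq

  disjoint-∪⁺ : {b p q : Subset n} → Disjoint b p → Disjoint b q → Disjoint b (p ∪ q)
  disjoint-∪⁺ {b = b} {p} {q} bp bq = begin
    b ∩ (p ∪ q)        ≡⟨ ∩-distribˡ-∪ b p q ⟩
    b ∩ p ∪ b ∩ q      ≡⟨ cong₂ _∪_ bp bq ⟩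
    ⊥ ∪ ⊥              ≡⟨ ∪-identityʳ ⊥ ⟩
    ⊥                  ∎
    where open ≡-Reasoning

  disjoint-⊆ʳ : {b p q : Subset n} → Disjoint b q → p ⊆ q → Disjoint b p
  disjoint-⊆ʳ {b = b} {p} {q} bq p⊆q = ⊆-antisym bp⊆⊥ (⊆-min (b ∩ p))
    where
    bp⊆⊥ : b ∩ p ⊆ ⊥
    bp⊆⊥ x∈bp with x∈p∩q⁻ b p x∈bp
    ... | x∈b , x∈p = subst (_ ∈_) bq (x∈p∩q⁺ (x∈b , p⊆q x∈p))

  disjoint-⊆ˡ : {p q c : Subset n} → p ⊆ q → Disjoint q c → Disjoint p c
  disjoint-⊆ˡ p⊆q qc = disjoint-sym (disjoint-⊆ʳ (disjoint-sym qc) p⊆q)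

  disjoint-∪⁻ : {b p q : Subset n} → Disjoint b (p ∪ q) → Disjoint b p × Disjoint b q
  disjoint-∪⁻ {p = p} {q} b[p∪q] = disjoint-⊆ʳ b[p∪q] (p⊆p∪q q) , disjoint-⊆ʳ b[p∪q] (q⊆p∪q p q)

  [p∪q]─p≡q : (p q : Subset n) → Disjoint p q → (p ∪ q) ─ p ≡ q
  [p∪q]─p≡q []           []           _  = refl
  [p∪q]─p≡q (true  ∷ p) (false ∷ q) pq = cong (outside ∷_) ([p∪q]─p≡q p q (Vec.∷-injectiveʳ pq))
  [p∪q]─p≡q (false ∷ p) (x     ∷ q) pq = cong (x ∷_) ([p∪q]─p≡q p q (Vec.∷-injectiveʳ pq))

  ∪-cancelˡ : {p q r : Subset n} → Disjoint p q → Disjoint p r → p ∪ q ≡ p ∪ r → q ≡ r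
  ∪-cancelˡ {p = p} {q} {r} pq pr p∪q≡p∪r = begin
    q              ≡⟨ sym ([p∪q]─p≡q p q pq) ⟩
    (p ∪ q) ─ p    ≡⟨ cong (_─ p) p∪q≡p∪r ⟩
    (p ∪ r) ─ p    ≡⟨ [p∪q]─p≡q p r pr ⟩
    r              ∎
    where open ≡-Reasoning

  p∪q≢p : {p q : Subset n} → 0 < ∣ q ∣ → Disjoint p q → p ∪ q ≢ p
  p∪q≢p {p = p} {q} 0<q pq p∪q≡p = ℕ.<-irrefl (cong ∣_∣ (sym p∪q≡p)) (begin-strict
    ∣ p ∣             ≡⟨ sym (ℕ.+-identityʳ ∣ p ∣) ⟩
    ∣ p ∣ ℕ.+ 0       <⟨ ℕ.+-monoʳ-< ∣ p ∣ 0<q ⟩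
    ∣ p ∣ ℕ.+ ∣ q ∣   ≡⟨ sym (∣p∪q∣≡∣p∣+∣q∣ p q pq) ⟩
    ∣ p ∪ q ∣         ∎)
    where open ℕ.≤-Reasoning

  p⊆q⇒p∪[q─p]≡q : {p q : Subset n} → p ⊆ q → p ∪ (q ─ p) ≡ q
  p⊆q⇒p∪[q─p]≡q {p = []}         {[]}         _   = refl
  p⊆q⇒p∪[q─p]≡q {p = true  ∷ p} {true  ∷ q} p⊆q = cong (inside ∷_) (p⊆q⇒p∪[q─p]≡q (drop-∷-⊆ p⊆q))
  p⊆q⇒p∪[q─p]≡q {p = false ∷ p} {x     ∷ q} p⊆q = cong (x ∷_) (p⊆q⇒p∪[q─p]≡q (drop-∷-⊆ p⊆q))
  p⊆q⇒p∪[q─p]≡q {p = true  ∷ p} {false ∷ q} p⊆q with p⊆q here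
  ... | ()

  disjoint-─ : (q p : Subset n) → Disjoint p (q ─ p)
  disjoint-─ []      []          = refl
  disjoint-─ (_ ∷ q) (true  ∷ p) = cong (outside ∷_) (disjoint-─ q p)
  disjoint-─ (_ ∷ q) (false ∷ p) = cong (outside ∷_) (disjoint-─ q p)

  ∣p∣≡0⇒p≡⊥ : (p : Subset n) → ∣ p ∣ ≡ 0 → p ≡ ⊥
  ∣p∣≡0⇒p≡⊥ []          _  = refl
  ∣p∣≡0⇒p≡⊥ (false ∷ p) p0 = cong (outside ∷_) (∣p∣≡0⇒p≡⊥ p p0)

  p─p≡⊥ : (p : Subset n) → p ─ p ≡ ⊥
  p─p≡⊥ p = trans (cong (_─ p) (sym (∪-identityʳ p))) ([p∪q]─p≡q p ⊥ (∩-zeroʳ p))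

  p⊆q∧q─p≡⊥⇒p≡q : {p q : Subset n} → p ⊆ q → q ─ p ≡ ⊥ → p ≡ q
  p⊆q∧q─p≡⊥⇒p≡q {p = p} {q} p⊆q q─p≡⊥ = begin
    p              ≡⟨ sym (∪-identityʳ p) ⟩
    p ∪ ⊥          ≡⟨ cong (p ∪_) (sym q─p≡⊥) ⟩
    p ∪ (q ─ p)    ≡⟨ p⊆q⇒p∪[q─p]≡q p⊆q ⟩
    q              ∎
    where open ≡-Reasoning

  infix 4 _≟ₛ_

  _≟ₛ_ : DecidableEquality (Subset n)
  _≟ₛ_ = Vec.≡-dec Bool._≟_

  subsets : Subset n → List (Subset n)
  subsets []          = [ [] ]
  subsets (true  ∷ b) = map (inside ∷_) (subsets b) ++ map (outside ∷_) (subsets b)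
  subsets (false ∷ b) = map (outside ∷_) (subsets b)

  ∈-subsets⁻ : {v b : Subset n} → v ∈ₗ subsets b → v ⊆ b
  ∈-subsets⁻ {v = []} {[]} _ ()
  ∈-subsets⁻ {b = true ∷ b} v∈ with ∈-++⁻ (map (inside ∷_) (subsets b)) v∈
  ... | inj₁ v∈ˡ with ∈-map⁻ (inside ∷_) v∈ˡ
  ...   | _ , v∈′ , refl = s⊆s (∈-subsets⁻ v∈′)
  ∈-subsets⁻ {b = true ∷ b} v∈ | inj₂ v∈ʳ with ∈-map⁻ (outside ∷_) v∈ʳ
  ...   | _ , v∈′ , refl = out⊆ (∈-subsets⁻ v∈′)
  ∈-subsets⁻ {b = false ∷ b} v∈ with ∈-map⁻ (outside ∷_) v∈
  ... | _ , v∈′ , refl = out⊆ (∈-subsets⁻ v∈′)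

  ∈-subsets⁺ : {v b : Subset n} → v ⊆ b → v ∈ₗ subsets b
  ∈-subsets⁺ {v = []}         {[]}         _   = here refl
  ∈-subsets⁺ {v = true  ∷ v} {true  ∷ b} v⊆b =
    ∈-++⁺ˡ (∈-map⁺ (inside ∷_) (∈-subsets⁺ (drop-∷-⊆ v⊆b)))
  ∈-subsets⁺ {v = false ∷ v} {true  ∷ b} v⊆b =
    ∈-++⁺ʳ (map (inside ∷_) (subsets b)) (∈-map⁺ (outside ∷_) (∈-subsets⁺ (drop-∷-⊆ v⊆b)))
  ∈-subsets⁺ {v = false ∷ v} {false ∷ b} v⊆b = ∈-map⁺ (outside ∷_) (∈-subsets⁺ (drop-∷-⊆ v⊆b))
  ∈-subsets⁺ {v = true  ∷ v} {false ∷ b} v⊆b with v⊆b here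
  ... | ()

  subsets-unique : (b : Subset n) → Unique (subsets b)
  subsets-unique []          = [] ∷ []
  subsets-unique (true  ∷ b) =
    Unique.++⁺ (Unique.map⁺ Vec.∷-injectiveʳ (subsets-unique b))
               (Unique.map⁺ Vec.∷-injectiveʳ (subsets-unique b))
      λ (v∈ˡ , v∈ʳ) → heads-differ (∈-map⁻ (inside ∷_) v∈ˡ) (∈-map⁻ (outside ∷_) v∈ʳ)
    where
    heads-differ : ∀ {v} → ∃ (λ u → u ∈ₗ subsets b × v ≡ inside ∷ u) →
                   ¬ ∃ (λ u → u ∈ₗ subsets b × v ≡ outside ∷ u)
    heads-differ (_ , _ , refl) (_ , _ , ())
  subsets-unique (false ∷ b) = Unique.map⁺ Vec.∷-injectiveʳ (subsets-unique b)

  -- splitSum m h sums h i j over the 2^m ways to split an m-set into parts of sizes i and j.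
  splitSum : ℕ → (ℕ → ℕ → ℤ) → ℤ
  splitSum zero    h = h 0 0
  splitSum (suc m) h = splitSum m (λ i j → h (suc i) j) + splitSum m (λ i j → h i (suc j))

  sum-subsets : (b : Subset n) (h : ℕ → ℕ → ℤ) →
                sumℤ (map (λ v → h ∣ v ∣ ∣ b ─ v ∣) (subsets b)) ≡ splitSum ∣ b ∣ h
  sum-subsets []          h = ℤ.+-identityʳ _
  sum-subsets (true  ∷ b) h = begin
    sumℤ (map H (map (inside ∷_) (subsets b) ++ map (outside ∷_) (subsets b)))
      ≡⟨ sum-map-++ H (map (inside ∷_) (subsets b)) _ ⟩
    sumℤ (map H (map (inside ∷_) (subsets b))) + sumℤ (map H (map (outside ∷_) (subsets b)))
      ≡⟨ cong₂ _+_ (cong sumℤ (sym (List.map-∘ (subsets b)))) (cong sumℤ (sym (List.map-∘ (subsets b)))) ⟩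
    sumℤ (map (λ v → h (suc ∣ v ∣) ∣ b ─ v ∣) (subsets b))
      + sumℤ (map (λ v → h ∣ v ∣ (suc ∣ b ─ v ∣)) (subsets b))
      ≡⟨ cong₂ _+_ (sum-subsets b (λ i j → h (suc i) j)) (sum-subsets b (λ i j → h i (suc j))) ⟩
    splitSum (suc ∣ b ∣) h ∎
    where
    open ≡-Reasoning
    H = λ v → h ∣ v ∣ ∣ (true ∷ b) ─ v ∣
  sum-subsets (false ∷ b) h = trans (cong sumℤ (sym (List.map-∘ (subsets b)))) (sum-subsets b h)

  splitSum-cong : ∀ m {h k : ℕ → ℕ → ℤ} → (∀ i j → i ℕ.+ j ≡ m → h i j ≡ k i j) →
                  splitSum m h ≡ splitSum m k
  splitSum-cong zero    h≗k = h≗k 0 0 refl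
  splitSum-cong (suc m) h≗k = cong₂ _+_
    (splitSum-cong m (λ i j e → h≗k (suc i) j (cong suc e)))
    (splitSum-cong m (λ i j e → h≗k i (suc j) (trans (ℕ.+-suc i j) (cong suc e))))

  splitSum-swap : ∀ m (h : ℕ → ℕ → ℤ) → splitSum m h ≡ splitSum m (λ i j → h j i)
  splitSum-swap zero    h = refl
  splitSum-swap (suc m) h = trans
    (cong₂ _+_ (splitSum-swap m (λ i j → h (suc i) j)) (splitSum-swap m (λ i j → h i (suc j))))
    (ℤ.+-comm (splitSum m (λ i j → h (suc j) i)) _)

  splitSum-+ : ∀ m (h k : ℕ → ℕ → ℤ) → splitSum m (λ i j → h i j + k i j) ≡ splitSum m h + splitSum m k
  splitSum-+ zero    h k = refl
  splitSum-+ (suc m) h k = trans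
    (cong₂ _+_ (splitSum-+ m (λ i j → h (suc i) j) (λ i j → k (suc i) j))
               (splitSum-+ m (λ i j → h i (suc j)) (λ i j → k i (suc j))))
    (+-interchange (splitSum m (λ i j → h (suc i) j)) (splitSum m (λ i j → k (suc i) j)) _ _)

  δ₀ : ℕ → ℤ
  δ₀ zero    = + 1
  δ₀ (suc _) = + 0

  splitSum-0 : ∀ m → splitSum m (λ _ _ → + 0) ≡ + 0
  splitSum-0 zero    = refl
  splitSum-0 (suc m) = cong₂ _+_ (splitSum-0 m) (splitSum-0 m)

  splitSum-δ₀ : ∀ m → splitSum m (λ i _ → δ₀ i) ≡ + 1
  splitSum-δ₀ zero    = refl
  splitSum-δ₀ (suc m) = cong₂ _+_ (splitSum-0 m) (splitSum-δ₀ m)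

  sumUpTo : ℕ → (ℕ → ℤ) → ℤ
  sumUpTo k f = sumℤ (applyUpTo f k)

  sumUpTo-cong : ∀ k {f g : ℕ → ℤ} → (∀ i → i < k → f i ≡ g i) → sumUpTo k f ≡ sumUpTo k g
  sumUpTo-cong zero    f≗g = refl
  sumUpTo-cong (suc k) f≗g = cong₂ _+_ (f≗g 0 (s≤s z≤n)) (sumUpTo-cong k (λ i i<k → f≗g (suc i) (s≤s i<k)))

  sumUpTo-+ : ∀ k (f g : ℕ → ℤ) → sumUpTo k (λ i → f i + g i) ≡ sumUpTo k f + sumUpTo k g
  sumUpTo-+ zero    f g = refl
  sumUpTo-+ (suc k) f g = trans
    (cong (_+_ (f 0 + g 0)) (sumUpTo-+ k (f ∘ suc) (g ∘ suc)))
    (+-interchange (f 0) (g 0) (sumUpTo k (f ∘ suc)) _)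

  sumUpTo-suc : ∀ k (f : ℕ → ℤ) → sumUpTo (suc k) f ≡ sumUpTo k f + f k
  sumUpTo-suc zero    f = trans (ℤ.+-identityʳ (f 0)) (sym (ℤ.+-identityˡ (f 0)))
  sumUpTo-suc (suc k) f = trans (cong (_+_ (f 0)) (sumUpTo-suc k (f ∘ suc))) (sym (ℤ.+-assoc (f 0) _ _))

  binomialSum : ℕ → (ℕ → ℕ → ℤ) → ℤ
  binomialSum m h = sumUpTo (suc m) (λ j → + (m C j) * h j (m ∸ j))

  splitSum≡binomialSum : ∀ m (h : ℕ → ℕ → ℤ) → splitSum m h ≡ binomialSum m h
  splitSum≡binomialSum zero    h = sym (trans (ℤ.+-identityʳ _) (ℤ.*-identityˡ _))
  splitSum≡binomialSum (suc m) h = begin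
    splitSum m h↑ + splitSum m h→
      ≡⟨ cong₂ _+_ (splitSum≡binomialSum m h↑) (splitSum≡binomialSum m h→) ⟩
    binomialSum m h↑ + binomialSum m h→
      ≡⟨ cong (_+_ (binomialSum m h↑)) binomialSum-h→ ⟩
    binomialSum m h↑ + (h 0 (suc m) + T)
      ≡⟨ sym (ℤ.+-assoc (binomialSum m h↑) _ T) ⟩
    binomialSum m h↑ + h 0 (suc m) + T
      ≡⟨ cong (_+ T) (ℤ.+-comm (binomialSum m h↑) _) ⟩
    h 0 (suc m) + binomialSum m h↑ + T
      ≡⟨ ℤ.+-assoc (h 0 (suc m)) _ T ⟩
    h 0 (suc m) + (binomialSum m h↑ + T)
      ≡⟨ cong₂ _+_ (sym (ℤ.*-identityˡ (h 0 (suc m)))) (sym pascal) ⟩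
    binomialSum (suc m) h ∎
    where
    open ≡-Reasoning
    h↑ h→ : ℕ → ℕ → ℤ
    h↑ i j = h (suc i) j
    h→ i j = h i (suc j)
    u t : ℕ → ℤ
    u j = + (m C j) * h (suc j) (m ∸ j)
    t j = + (m C suc j) * h (suc j) (m ∸ j)
    T = sumUpTo (suc m) t
    pascal : sumUpTo (suc m) (λ j → + (suc m C suc j) * h (suc j) (m ∸ j)) ≡ binomialSum m h↑ + T
    pascal = trans
      (sumUpTo-cong (suc m) {g = λ j → u j + t j} (λ j _ → begin
        + (suc m C suc j) * h (suc j) (m ∸ j)
          ≡⟨ cong (λ c → + c * h (suc j) (m ∸ j)) (sym (nCk+nC[k+1]≡[n+1]C[k+1] m j)) ⟩
        + (m C j ℕ.+ m C suc j) * h (suc j) (m ∸ j)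
          ≡⟨ ℤ.*-distribʳ-+ (h (suc j) (m ∸ j)) (+ (m C j)) (+ (m C suc j)) ⟩
        u j + t j ∎))
      (sumUpTo-+ (suc m) u t)
    binomialSum-h→ : binomialSum m h→ ≡ h 0 (suc m) + T
    binomialSum-h→ = cong₂ _+_ (ℤ.*-identityˡ (h 0 (suc m))) (sym (begin
      T
        ≡⟨ sumUpTo-suc m t ⟩
      sumUpTo m t + + (m C suc m) * h (suc m) (m ∸ m)
        ≡⟨ cong (λ c → sumUpTo m t + + c * h (suc m) (m ∸ m)) (k>n⇒nCk≡0 (ℕ.n<1+n m)) ⟩
      sumUpTo m t + + 0
        ≡⟨ ℤ.+-identityʳ _ ⟩
      sumUpTo m t
        ≡⟨ sumUpTo-cong m (λ j j<m → cong (λ r → + (m C suc j) * h (suc j) r) (ℕ.+-∸-assoc 1 j<m)) ⟩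
      sumUpTo m (λ j → + (m C suc j) * h→ (suc j) (m ∸ suc j)) ∎))

  zipWith-applyUpTo-downFrom : {C : Set} (_∙_ : A → B → C) (f : ℕ → A) (g : ℕ → B) (m : ℕ) →
    zipWith _∙_ (applyUpTo f m) (map g (downFrom m)) ≡ applyUpTo (λ i → f i ∙ g (m ∸ suc i)) m
  zipWith-applyUpTo-downFrom _∙_ f g zero    = refl
  zipWith-applyUpTo-downFrom _∙_ f g (suc m) =
    cong (f 0 ∙ g m ∷_) (zipWith-applyUpTo-downFrom _∙_ (f ∘ suc) g m)

  -- Integer d-divisible Euler numbers

  GoodSize : ℕ → ℕ → Set
  GoodSize d k = (0 < k) × (d ∣ k)

  goodSize? : ∀ d k → Dec (GoodSize d k)
  goodSize? d k = (0 ℕ.<? k) ×-dec (d ∣? k)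

  module _ (d : ℕ) where

    onMultiples : ℕ → ℤ → ℤ
    onMultiples j x = if does (d ∣? j) then x else + 0

    onGoodSizes : ℕ → ℤ → ℤ
    onGoodSizes j x = if does (goodSize? d j) then x else + 0

    -- [E m, …, E 0], where E m = - Σ_{i=1}^{m} [d ∣ i] (m choose i) E (m - i), mirroring invCoeffs.
    eulerList : ℕ → List ℤ
    eulerList zero    = + 1 ∷ []
    eulerList (suc m) =
      - sumℤ (zipWith _*_ (map (λ i → onMultiples (suc i) (+ (suc m C suc i))) (upTo (suc m)))
                          (eulerList m))
      ∷ eulerList m

    euler : ℕ → ℤ
    euler m = fromMaybe (+ 0) (List.head (eulerList m))

    eulerList≡map-euler : ∀ m → eulerList m ≡ map euler (downFrom (suc m))
    eulerList≡map-euler zero    = refl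
    eulerList≡map-euler (suc m) = cong (euler (suc m) ∷_) (eulerList≡map-euler m)

    euler-suc : ∀ k → euler (suc k) ≡
                - sumUpTo (suc k) (λ i → onMultiples (suc i) (+ (suc k C suc i)) * euler (k ∸ i))
    euler-suc k = cong (λ xs → - sumℤ xs) (begin
      zipWith _*_ (map c (upTo (suc k))) (eulerList k)
        ≡⟨ cong₂ (zipWith _*_) (List.map-applyUpTo (λ i → i) c (suc k)) (eulerList≡map-euler k) ⟩
      zipWith _*_ (applyUpTo c (suc k)) (map euler (downFrom (suc k)))
        ≡⟨ zipWith-applyUpTo-downFrom _*_ c euler (suc k) ⟩
      applyUpTo (λ i → c i * euler (k ∸ i)) (suc k) ∎)
      where
      open ≡-Reasoning
      c : ℕ → ℤ
      c i = onMultiples (suc i) (+ (suc k C suc i))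

    euler-recursion : ∀ m → 0 < m → binomialSum m (λ i j → onMultiples i (euler j)) ≡ + 0
    euler-recursion (suc k) _ = begin
      + 1 * onMultiples 0 (euler (suc k))
        + sumUpTo (suc k) (λ i → + (suc k C suc i) * onMultiples (suc i) (euler (k ∸ i)))
        ≡⟨ cong₂ _+_ (trans (ℤ.*-identityˡ _) onMultiples-0) (sumUpTo-cong (suc k) (λ i _ → pull-mask i)) ⟩
      euler (suc k) + S
        ≡⟨ cong (_+ S) (euler-suc k) ⟩
      - S + S
        ≡⟨ ℤ.+-inverseˡ S ⟩
      + 0 ∎
      where
      open ≡-Reasoning
      S = sumUpTo (suc k) (λ i → onMultiples (suc i) (+ (suc k C suc i)) * euler (k ∸ i))
      onMultiples-0 : onMultiples 0 (euler (suc k)) ≡ euler (suc k)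
      onMultiples-0 with d ∣? 0
      ... | yes _   = refl
      ... | no  d∤0 = ⊥-elim (d∤0 (d ∣0))
      pull-mask : ∀ i → + (suc k C suc i) * onMultiples (suc i) (euler (k ∸ i))
                      ≡ onMultiples (suc i) (+ (suc k C suc i)) * euler (k ∸ i)
      pull-mask i with d ∣? suc i
      ... | yes _ = refl
      ... | no  _ = ℤ.*-zeroʳ (+ (suc k C suc i))

    euler-splitSum : ∀ m → 0 < m → d ∣ m → splitSum m (λ i _ → onGoodSizes i (euler i)) ≡ - + 1
    euler-splitSum m 0<m d∣m = ∙-cancelʳ (+ 1) _ (- + 1) (begin
      splitSum m (λ i _ → good i) + + 1
        ≡⟨ cong (_+_ (splitSum m (λ i _ → good i))) (sym (splitSum-δ₀ m)) ⟩
      splitSum m (λ i _ → good i) + splitSum m (λ i _ → δ₀ i)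
        ≡⟨ sym (splitSum-+ m _ _) ⟩
      splitSum m (λ i _ → good i + δ₀ i)
        ≡⟨ splitSum-cong m (λ i _ _ → good+δ₀ i) ⟩
      splitSum m (λ i _ → onMultiples i (euler i))
        ≡⟨ splitSum-cong m (λ i j i+j≡m → mask-complement i j (subst (d ∣_) (sym i+j≡m) d∣m)) ⟩
      splitSum m (λ i j → onMultiples j (euler i))
        ≡⟨ splitSum-swap m _ ⟩
      splitSum m (λ i j → onMultiples i (euler j))
        ≡⟨ splitSum≡binomialSum m _ ⟩
      binomialSum m (λ i j → onMultiples i (euler j))
        ≡⟨ euler-recursion m 0<m ⟩
      + 0 ∎)
      where
      open ≡-Reasoning
      good : ℕ → ℤ
      good i = onGoodSizes i (euler i)
      good+δ₀ : ∀ i → good i + δ₀ i ≡ onMultiples i (euler i)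
      good+δ₀ zero with d ∣? 0
      ... | yes _   = refl
      ... | no  d∤0 = ⊥-elim (d∤0 (d ∣0))
      good+δ₀ (suc i) with d ∣? suc i
      ... | yes _ = ℤ.+-identityʳ _
      ... | no  _ = refl
      mask-complement : ∀ i j {x} → d ∣ i ℕ.+ j → onMultiples i x ≡ onMultiples j x
      mask-complement i j d∣i+j with d ∣? i | d ∣? j
      ... | yes _   | yes _   = refl
      ... | no  _   | no  _   = refl
      ... | yes d∣i | no  d∤j = ⊥-elim (d∤j (∣m+n∣m⇒∣n d∣i+j d∣i))
      ... | no  d∤i | yes d∣j = ⊥-elim (d∤i (∣m+n∣m⇒∣n (subst (d ∣_) (ℕ.+-comm i j) d∣i+j) d∣j))

  toℚᵘ-toℚ : ∀ z → ℚ.toℚᵘ (toℚ z) ℚᵘ.≃ mkℚᵘ z 0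
  toℚᵘ-toℚ z = ℚ.toℚᵘ-fromℚᵘ (mkℚᵘ z 0)

  toℚ-+ : ∀ x y → toℚ (x + y) ≡ toℚ x ℚ.+ toℚ y
  toℚ-+ x y = ℚ.toℚᵘ-injective (begin
    ℚ.toℚᵘ (toℚ (x + y))                 ≈⟨ toℚᵘ-toℚ (x + y) ⟩
    mkℚᵘ (x + y) 0                        ≈⟨ *≡* (cong (_* + 1) (sym (cong₂ _+_ (ℤ.*-identityʳ x) (ℤ.*-identityʳ y)))) ⟩
    mkℚᵘ x 0 ℚᵘ.+ mkℚᵘ y 0                ≈⟨ ℚᵘ.+-cong (toℚᵘ-toℚ x) (toℚᵘ-toℚ y) ⟨
    ℚ.toℚᵘ (toℚ x) ℚᵘ.+ ℚ.toℚᵘ (toℚ y)   ≈⟨ ℚ.toℚᵘ-homo-+ (toℚ x) (toℚ y) ⟨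
    ℚ.toℚᵘ (toℚ x ℚ.+ toℚ y)             ∎)
    where open ℚᵘ.≃-Reasoning

  toℚ-* : ∀ x y → toℚ (x * y) ≡ toℚ x ℚ.* toℚ y
  toℚ-* x y = ℚ.toℚᵘ-injective (begin
    ℚ.toℚᵘ (toℚ (x * y))                 ≈⟨ toℚᵘ-toℚ (x * y) ⟩
    mkℚᵘ x 0 ℚᵘ.* mkℚᵘ y 0                ≈⟨ ℚᵘ.*-cong (toℚᵘ-toℚ x) (toℚᵘ-toℚ y) ⟨
    ℚ.toℚᵘ (toℚ x) ℚᵘ.* ℚ.toℚᵘ (toℚ y)   ≈⟨ ℚ.toℚᵘ-homo-* (toℚ x) (toℚ y) ⟨
    ℚ.toℚᵘ (toℚ x ℚ.* toℚ y)             ∎)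
    where open ℚᵘ.≃-Reasoning

  toℚ-neg : ∀ x → toℚ (- x) ≡ ℚ.- toℚ x
  toℚ-neg x = ℚ.toℚᵘ-injective (begin
    ℚ.toℚᵘ (toℚ (- x))       ≈⟨ toℚᵘ-toℚ (- x) ⟩
    ℚᵘ.- mkℚᵘ x 0             ≈⟨ ℚᵘ.-‿cong (toℚᵘ-toℚ x) ⟨
    ℚᵘ.- ℚ.toℚᵘ (toℚ x)      ≈⟨ ℚ.toℚᵘ-homo‿- (toℚ x) ⟨
    ℚ.toℚᵘ (ℚ.- toℚ x)       ∎)
    where open ℚᵘ.≃-Reasoning

  recip : (a : ℕ) .{{_ : NonZero a}} → ℚ
  recip a = ℚ._/_ (+ 1) a

  toℚᵘ-recip : ∀ a .{{_ : NonZero a}} → ℚ.toℚᵘ (recip a) ℚᵘ.≃ mkℚᵘ (+ 1) (ℕ.pred a)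
  toℚᵘ-recip (suc a) = ℚ.toℚᵘ-fromℚᵘ (mkℚᵘ (+ 1) a)

  recip-* : ∀ a b c m .{{_ : NonZero a}} .{{_ : NonZero b}} .{{_ : NonZero m}} →
            c ℕ.* (a ℕ.* b) ≡ m → recip a ℚ.* recip b ≡ toℚ (+ c) ℚ.* recip m
  recip-* a@(suc _) b@(suc _) c m@(suc _) c*ab≡m = ℚ.toℚᵘ-injective (begin
    ℚ.toℚᵘ (recip a ℚ.* recip b)                      ≈⟨ ℚ.toℚᵘ-homo-* (recip a) (recip b) ⟩
    ℚ.toℚᵘ (recip a) ℚᵘ.* ℚ.toℚᵘ (recip b)           ≈⟨ ℚᵘ.*-cong (toℚᵘ-recip a) (toℚᵘ-recip b) ⟩
    mkℚᵘ (+ 1) (ℕ.pred a) ℚᵘ.* mkℚᵘ (+ 1) (ℕ.pred b) ≈⟨ *≡* cross ⟩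
    mkℚᵘ (+ c) 0 ℚᵘ.* mkℚᵘ (+ 1) (ℕ.pred m)          ≈⟨ ℚᵘ.*-cong (toℚᵘ-toℚ (+ c)) (toℚᵘ-recip m) ⟨
    ℚ.toℚᵘ (toℚ (+ c)) ℚᵘ.* ℚ.toℚᵘ (recip m)         ≈⟨ ℚ.toℚᵘ-homo-* (toℚ (+ c)) (recip m) ⟨
    ℚ.toℚᵘ (toℚ (+ c) ℚ.* recip m)                    ∎)
    where
    open ℚᵘ.≃-Reasoning
    cross : + 1 * + 1 * + (1 ℕ.* m) ≡ + c * + 1 * + (a ℕ.* b)
    cross = trans (ℤ.*-identityˡ (+ (1 ℕ.* m))) (trans (cong +_ (trans (ℕ.*-identityˡ m) (sym c*ab≡m)))
              (trans (ℤ.pos-* c (a ℕ.* b)) (cong (_* + (a ℕ.* b)) (sym (ℤ.*-identityʳ (+ c))))))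

  toℚ-*-recip : ∀ a .{{_ : NonZero a}} → toℚ (+ a) ℚ.* recip a ≡ 1ℚ
  toℚ-*-recip a@(suc _) = ℚ.toℚᵘ-injective (begin
    ℚ.toℚᵘ (toℚ (+ a) ℚ.* recip a)                 ≈⟨ ℚ.toℚᵘ-homo-* (toℚ (+ a)) (recip a) ⟩
    ℚ.toℚᵘ (toℚ (+ a)) ℚᵘ.* ℚ.toℚᵘ (recip a)      ≈⟨ ℚᵘ.*-cong (toℚᵘ-toℚ (+ a)) (toℚᵘ-recip a) ⟩
    mkℚᵘ (+ a) 0 ℚᵘ.* mkℚᵘ (+ 1) (ℕ.pred a)       ≈⟨ *≡* cross ⟩
    mkℚᵘ (+ 1) 0                                   ∎)
    where
    open ℚᵘ.≃-Reasoning
    cross : + a * + 1 * + 1 ≡ + 1 * + (1 ℕ.* a)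
    cross = trans (ℤ.*-identityʳ _) (trans (ℤ.*-identityʳ _)
              (trans (cong +_ (sym (ℕ.*-identityˡ a))) (sym (ℤ.*-identityˡ _))))

  sumℚ : List ℚ → ℚ
  sumℚ = foldr ℚ._+_ 0ℚ

  sumℚ-toℚ-*ʳ : ∀ k (t : ℕ → ℤ) (c : ℚ) {g : ℕ → ℚ} → (∀ i → i < k → g i ≡ toℚ (t i) ℚ.* c) →
                sumℚ (applyUpTo g k) ≡ toℚ (sumUpTo k t) ℚ.* c
  sumℚ-toℚ-*ʳ zero    t c g≡ = sym (ℚ.*-zeroˡ c)
  sumℚ-toℚ-*ʳ (suc k) t c {g} g≡ = begin
    g 0 ℚ.+ sumℚ (applyUpTo (g ∘ suc) k)
      ≡⟨ cong₂ ℚ._+_ (g≡ 0 (s≤s z≤n)) (sumℚ-toℚ-*ʳ k (t ∘ suc) c (λ i i<k → g≡ (suc i) (s≤s i<k))) ⟩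
    toℚ (t 0) ℚ.* c ℚ.+ toℚ (sumUpTo k (t ∘ suc)) ℚ.* c
      ≡⟨ sym (ℚ.*-distribʳ-+ c (toℚ (t 0)) _) ⟩
    (toℚ (t 0) ℚ.+ toℚ (sumUpTo k (t ∘ suc))) ℚ.* c
      ≡⟨ cong (ℚ._* c) (sym (toℚ-+ (t 0) _)) ⟩
    toℚ (sumUpTo (suc k) t) ℚ.* c ∎
    where open ≡-Reasoning

  module _ (d : ℕ) where

    inv! : ℕ → ℚ
    inv! j = recip (j !) {{j !≢0}}

    scaledEuler : ℕ → ℚ
    scaledEuler j = toℚ (euler d j) ℚ.* inv! j

    fcoeff-*-scaledEuler : ∀ k i → i ≤ k →
      fcoeff d (suc i) ℚ.* scaledEuler (k ∸ i)
        ≡ toℚ (onMultiples d (suc i) (+ (suc k C suc i)) * euler d (k ∸ i)) ℚ.* inv! (suc k)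
    fcoeff-*-scaledEuler k i i≤k with d ∣? suc i
    ... | no  _ = trans (ℚ.*-zeroˡ (scaledEuler (k ∸ i))) (sym (ℚ.*-zeroˡ (inv! (suc k))))
    ... | yes _ = begin
      inv! (suc i) ℚ.* (e ℚ.* inv! (k ∸ i))
        ≡⟨ solve 3 (λ x y z → x :* (y :* z) := y :* (x :* z)) refl (inv! (suc i)) e (inv! (k ∸ i)) ⟩
      e ℚ.* (inv! (suc i) ℚ.* inv! (k ∸ i))
        ≡⟨ cong (e ℚ.*_) (recip-* (suc i !) ((k ∸ i) !) c (suc k !)
                                   {{suc i !≢0}} {{(k ∸ i) !≢0}} {{suc k !≢0}} c*i!*[k∸i]!≡k!) ⟩
      e ℚ.* (toℚ (+ c) ℚ.* inv! (suc k))
        ≡⟨ solve 3 (λ x y z → x :* (y :* z) := (y :* x) :* z) refl e (toℚ (+ c)) (inv! (suc k)) ⟩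
      (toℚ (+ c) ℚ.* e) ℚ.* inv! (suc k)
        ≡⟨ cong (ℚ._* inv! (suc k)) (sym (toℚ-* (+ c) (euler d (k ∸ i)))) ⟩
      toℚ (+ c * euler d (k ∸ i)) ℚ.* inv! (suc k) ∎
      where
      open ≡-Reasoning
      open +-*-Solver
      e = toℚ (euler d (k ∸ i))
      c = suc k C suc i
      c*i!*[k∸i]!≡k! : c ℕ.* (suc i ! ℕ.* (k ∸ i) !) ≡ suc k !
      c*i!*[k∸i]!≡k! = trans (cong (ℕ._* (suc i ! ℕ.* (k ∸ i) !)) (nCk≡n!/k![n-k]! (s≤s i≤k)))
                            (m/n*n≡m {{suc i !* (k ∸ i) !≢0}} (k![n∸k]!∣n! (s≤s i≤k)))

    invCoeffs≡ : ∀ k → invCoeffs d k ≡ map scaledEuler (downFrom (suc k))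
    invCoeffs≡ zero    = cong (_∷ []) (sym (ℚ.*-identityˡ 1ℚ))
    invCoeffs≡ (suc k) rewrite invCoeffs≡ k = cong (_∷ map scaledEuler (downFrom (suc k))) (begin
      ℚ.- sumℚ (zipWith ℚ._*_ (map f (upTo (suc k))) (map scaledEuler (downFrom (suc k))))
        ≡⟨ cong (λ fs → ℚ.- sumℚ (zipWith ℚ._*_ fs (map scaledEuler (downFrom (suc k)))))
                (List.map-applyUpTo (λ i → i) f (suc k)) ⟩
      ℚ.- sumℚ (zipWith ℚ._*_ (applyUpTo f (suc k)) (map scaledEuler (downFrom (suc k))))
        ≡⟨ cong (λ ts → ℚ.- sumℚ ts) (zipWith-applyUpTo-downFrom ℚ._*_ f scaledEuler (suc k)) ⟩
      ℚ.- sumℚ (applyUpTo (λ i → f i ℚ.* scaledEuler (k ∸ i)) (suc k))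
        ≡⟨ cong ℚ.-_ (sumℚ-toℚ-*ʳ (suc k) t (inv! (suc k))
                                   (λ i i<1+k → fcoeff-*-scaledEuler k i (ℕ.≤-pred i<1+k))) ⟩
      ℚ.- (toℚ (sumUpTo (suc k) t) ℚ.* inv! (suc k))
        ≡⟨ ℚ.neg-distribˡ-* (toℚ (sumUpTo (suc k) t)) (inv! (suc k)) ⟩
      ℚ.- toℚ (sumUpTo (suc k) t) ℚ.* inv! (suc k)
        ≡⟨ cong (ℚ._* inv! (suc k)) (sym (toℚ-neg (sumUpTo (suc k) t))) ⟩
      toℚ (- sumUpTo (suc k) t) ℚ.* inv! (suc k)
        ≡⟨ cong (λ x → toℚ x ℚ.* inv! (suc k)) (sym (euler-suc d k)) ⟩
      scaledEuler (suc k) ∎)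
      where
      open ≡-Reasoning
      f : ℕ → ℚ
      f i = fcoeff d (suc i)
      t : ℕ → ℤ
      t i = onMultiples d (suc i) (+ (suc k C suc i)) * euler d (k ∸ i)

    toℚ-euler : ∀ m → toℚ (euler d m) ≡ 𝓔 d m
    toℚ-euler m rewrite invCoeffs≡ m = sym (begin
      toℚ (+ (m !)) ℚ.* (toℚ (euler d m) ℚ.* inv! m)
        ≡⟨ solve 3 (λ x y z → x :* (y :* z) := y :* (x :* z)) refl
                 (toℚ (+ (m !))) (toℚ (euler d m)) (inv! m) ⟩
      toℚ (euler d m) ℚ.* (toℚ (+ (m !)) ℚ.* inv! m)
        ≡⟨ cong (toℚ (euler d m) ℚ.*_) (toℚ-*-recip (m !) {{m !≢0}}) ⟩
      toℚ (euler d m) ℚ.* 1ℚ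
        ≡⟨ ℚ.*-identityʳ _ ⟩
      toℚ (euler d m) ∎)
      where
      open ≡-Reasoning
      open +-*-Solver

  -- Coarsenings of block lists

  ⋃ : List (Subset n) → Subset n
  ⋃ = foldr _∪_ ⊥

  infix 4 _≼_ _⋖ₗ_

  -- bs ≼ ws: ws arises from bs by uniting runs of consecutive blocks; glue joins b to the next run.
  data _≼_ {n : ℕ} : List (Subset n) → List (Subset n) → Set where
    []   : [] ≼ []
    cut  : ∀ {b bs ws} → bs ≼ ws → b ∷ bs ≼ b ∷ ws
    glue : ∀ {b bs w ws} → bs ≼ w ∷ ws → b ∷ bs ≼ b ∪ w ∷ ws

  -- The covering relation of Defs on bare block lists: ψ ⋖ ω is by definition blocks ψ ⋖ₗ blocks ω.
  _⋖ₗ_ : List (Subset n) → List (Subset n) → Set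
  xs ⋖ₗ ys = ∃[ pre ] ∃[ b₁ ] ∃[ b₂ ] ∃[ suf ]
    (xs ≡ pre ++ b₁ ∷ b₂ ∷ suf) × (ys ≡ pre ++ (b₁ ∪ b₂) ∷ suf)

  ≼-refl : (bs : List (Subset n)) → bs ≼ bs
  ≼-refl []       = []
  ≼-refl (b ∷ bs) = cut (≼-refl bs)

  ≼-⋃ : {bs ws : List (Subset n)} → bs ≼ ws → ⋃ bs ≡ ⋃ ws
  ≼-⋃ []                                = refl
  ≼-⋃ {bs = b ∷ _} (cut D)              = cong (b ∪_) (≼-⋃ D)
  ≼-⋃ {bs = b ∷ _} (glue {w = w} {ws} D) = trans (cong (b ∪_) (≼-⋃ D)) (sym (∪-assoc b w (⋃ ws)))

  ≼-length : {bs ws : List (Subset n)} → bs ≼ ws → length ws ≤ length bs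
  ≼-length []       = z≤n
  ≼-length (cut D)  = s≤s (≼-length D)
  ≼-length (glue D) = ℕ.m≤n⇒m≤1+n (≼-length D)

  ≼-length-≡ : {bs ws : List (Subset n)} → bs ≼ ws → length bs ≡ length ws → bs ≡ ws
  ≼-length-≡ []                     _  = refl
  ≼-length-≡ {bs = b ∷ _} (cut D)  eq = cong (b ∷_) (≼-length-≡ D (ℕ.suc-injective eq))
  ≼-length-≡ (glue D)              eq = ⊥-elim (ℕ.<-irrefl (sym (ℕ.suc-injective eq)) (≼-length D))

  ≼-glueAt : (pre : List (Subset n)) {b₁ b₂ : Subset n} {bs suf : List (Subset n)} →
             bs ≼ pre ++ b₁ ∷ b₂ ∷ suf → bs ≼ pre ++ (b₁ ∪ b₂) ∷ suf
  ≼-glueAt []        (cut D)                          = glue D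
  ≼-glueAt [] {b₂ = b₂} (glue {b = b} {w = w} D)      =
    subst (λ c → _ ≼ c ∷ _) (sym (∪-assoc b w b₂)) (glue (≼-glueAt [] D))
  ≼-glueAt (_ ∷ pre) (cut D)                          = cut (≼-glueAt pre D)
  ≼-glueAt (_ ∷ pre) (glue {w = w} D)                 = glue (≼-glueAt (w ∷ pre) D)

  ≼-⋖ₗ : {bs xs ys : List (Subset n)} → bs ≼ xs → xs ⋖ₗ ys → bs ≼ ys
  ≼-⋖ₗ D (pre , _ , _ , _ , refl , refl) = ≼-glueAt pre D

  Star-⋖ₗ-∷ : {b : Subset n} {xs ys : List (Subset n)} → Star _⋖ₗ_ xs ys → Star _⋖ₗ_ (b ∷ xs) (b ∷ ys)
  Star-⋖ₗ-∷ ε                                      = ε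
  Star-⋖ₗ-∷ {b = b} ((pre , b₁ , b₂ , suf , refl , refl) ◅ steps) =
    (b ∷ pre , b₁ , b₂ , suf , refl , refl) ◅ Star-⋖ₗ-∷ steps

  ≼⇒Star : {bs ws : List (Subset n)} → bs ≼ ws → Star _⋖ₗ_ bs ws
  ≼⇒Star []                               = ε
  ≼⇒Star (cut D)                          = Star-⋖ₗ-∷ (≼⇒Star D)
  ≼⇒Star (glue {b = b} {w = w} {ws} D) = Star-⋖ₗ-∷ (≼⇒Star D) ◅◅ (([] , b , w , ws , refl , refl) ◅ ε)

  DivBlocks : ℕ → List (Subset n) → Set
  DivBlocks d bs = All (λ b → GoodSize d ∣ b ∣) bs × AllPairs Disjoint bs

  disjoint-⋃⁺ : {b : Subset n} (ws : List (Subset n)) → All (Disjoint b) ws → Disjoint b (⋃ ws)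
  disjoint-⋃⁺ {b = b} []       []         = ∩-zeroʳ b
  disjoint-⋃⁺         (w ∷ ws) (bw ∷ bws) = disjoint-∪⁺ bw (disjoint-⋃⁺ ws bws)

  disjoint-⋃⁻ : {b : Subset n} (ws : List (Subset n)) → Disjoint b (⋃ ws) → All (Disjoint b) ws
  disjoint-⋃⁻ []       _  = []
  disjoint-⋃⁻ (w ∷ ws) b⋃ = proj₁ (disjoint-∪⁻ b⋃) ∷ disjoint-⋃⁻ ws (proj₂ (disjoint-∪⁻ b⋃))

  ∪-goodSize : ∀ {d} {b w : Subset n} → GoodSize d ∣ b ∣ → GoodSize d ∣ w ∣ → Disjoint b w →
               GoodSize d ∣ b ∪ w ∣
  ∪-goodSize {d = d} {b} {w} (0<b , d∣b) (_ , d∣w) bw =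
    subst (GoodSize d) (sym (∣p∪q∣≡∣p∣+∣q∣ b w bw)) (ℕ.<-≤-trans 0<b (ℕ.m≤m+n _ _) , ∣m∣n⇒∣m+n d∣b d∣w)

  ≼-divBlocks : ∀ {d} {bs ws : List (Subset n)} → DivBlocks d bs → bs ≼ ws → DivBlocks d ws
  ≼-divBlocks valid []                                   = valid
  ≼-divBlocks {bs = b ∷ bs} (gb ∷ gbs , b# ∷ bs#) (cut {ws = ws} D)
    with ≼-divBlocks (gbs , bs#) D
  ... | gws , ws# = gb ∷ gws , disjoint-⋃⁻ ws (subst (Disjoint b) (≼-⋃ D) (disjoint-⋃⁺ bs b#)) ∷ ws#
  ≼-divBlocks {bs = b ∷ bs} (gb ∷ gbs , b# ∷ bs#) (glue {w = w} {ws} D)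
    with ≼-divBlocks (gbs , bs#) D
  ... | gw ∷ gws , w# ∷ ws# =
    ∪-goodSize gb gw bw ∷ gws ,
    All.zipWith (λ (bv , wv) → disjoint-sym (disjoint-∪⁺ (disjoint-sym bv) (disjoint-sym wv)))
                (disjoint-⋃⁻ ws b⋃ws , w#) ∷ ws#
    where
    b⋃ : Disjoint b (w ∪ ⋃ ws)
    b⋃ = subst (Disjoint b) (≼-⋃ D) (disjoint-⋃⁺ bs b#)
    bw : Disjoint b w
    bw = proj₁ (disjoint-∪⁻ b⋃)
    b⋃ws : Disjoint b (⋃ ws)
    b⋃ws = proj₂ (disjoint-∪⁻ b⋃)

  ≼-isDivOSP : ∀ {d} {bs ws : List (Subset n)} → IsDivOSP n d bs → bs ≼ ws → IsDivOSP n d ws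
  ≼-isDivOSP (gbs , bs# , ⋃bs≡⊤) D with ≼-divBlocks (gbs , bs#) D
  ... | gws , ws# = gws , ws# , trans (sym (≼-⋃ D)) ⋃bs≡⊤

  isDivOSP? : ∀ n d (bs : List (Subset n)) → Dec (IsDivOSP n d bs)
  isDivOSP? n d bs =
    all? (λ b → goodSize? d ∣ b ∣) bs ×-dec allPairs? (λ b c → b ∩ c ≟ₛ ⊥) bs ×-dec (⋃ bs ≟ₛ ⊤)

  length*d≤∣⋃∣ : ∀ {d} (bs : List (Subset n)) → DivBlocks d bs → length bs ℕ.* d ≤ ∣ ⋃ bs ∣
  length*d≤∣⋃∣         []       _                   = z≤n
  length*d≤∣⋃∣ {d = d} (b ∷ bs) ((0<b , d∣b) ∷ gbs , b# ∷ bs#) = begin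
    d ℕ.+ length bs ℕ.* d      ≤⟨ ℕ.+-mono-≤ (∣⇒≤ {{ℕ.>-nonZero 0<b}} d∣b) (length*d≤∣⋃∣ bs (gbs , bs#)) ⟩
    ∣ b ∣ ℕ.+ ∣ ⋃ bs ∣         ≡⟨ sym (∣p∪q∣≡∣p∣+∣q∣ b (⋃ bs) (disjoint-⋃⁺ bs b#)) ⟩
    ∣ ⋃ (b ∷ bs) ∣             ∎
    where open ℕ.≤-Reasoning

  size : List (Subset n) → ℕ
  size bs = sum (map ∣_∣ bs)

  size≡∣⋃∣ : (bs : List (Subset n)) → AllPairs Disjoint bs → size bs ≡ ∣ ⋃ bs ∣
  size≡∣⋃∣ {n} []       []          = sym (∣⊥∣≡0 n)
  size≡∣⋃∣     (b ∷ bs) (b# ∷ bs#) =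
    trans (cong (∣ b ∣ ℕ.+_) (size≡∣⋃∣ bs bs#)) (sym (∣p∪q∣≡∣p∣+∣q∣ b (⋃ bs) (disjoint-⋃⁺ bs b#)))

  ≤P⇒≼ : ∀ {d} {ψ ω : OSP n d} → ψ ≤P ω → blocks ψ ≼ blocks ω
  ≤P⇒≼ {ψ = ψ} = go (≼-refl (blocks ψ))
    where
    go : ∀ {χ ω} → blocks ψ ≼ blocks χ → χ ≤P ω → blocks ψ ≼ blocks ω
    go D ε              = D
    go D (step ◅ steps) = go (≼-⋖ₗ D step) steps

  ≼⇒≤P : ∀ {d} (ψ ω : OSP n d) → blocks ψ ≼ blocks ω → ψ ≤P ω
  ≼⇒≤P {n} {d} (osp bs v) (osp ws _) D = lift (≼-refl bs) D (≼⇒Star D)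
    where
    lift : ∀ {xs ys} (Dx : bs ≼ xs) (Dy : bs ≼ ys) → Star _⋖ₗ_ xs ys →
           osp {n} {d} xs (≼-isDivOSP v Dx) ≤P osp ys (≼-isDivOSP v Dy)
    lift Dx Dy ε              = ε
    lift Dx Dy (step ◅ steps) = step ◅ lift (≼-⋖ₗ Dx step) Dy steps

  -- The poset Ω and its Möbius function

  module _ {n d : ℕ} where

    blocks-injective : {ψ ω : OSP n d} → blocks ψ ≡ blocks ω → ψ ≡ ω
    blocks-injective {osp _ _} {osp _ _} refl = refl

    -- Block lists that are not valid are sent to the junk value 0̂.
    fromBlocks : List (Subset n) → Ω n d
    fromBlocks bs with isDivOSP? n d bs
    ... | yes v = just (osp bs v)
    ... | no  _ = nothing

    fromBlocks-valid : (bs : List (Subset n)) → .(v : IsDivOSP n d bs) → fromBlocks bs ≡ just (osp bs v)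
    fromBlocks-valid bs v with isDivOSP? n d bs
    ... | yes _ = refl
    ... | no ¬v = ⊥-elim (¬v (recompute (isDivOSP? n d bs) v))

    isDivOSP-blocks : (ω : OSP n d) → IsDivOSP n d (blocks ω)
    isDivOSP-blocks (osp bs v) = recompute (isDivOSP? n d bs) v

    divBlocks : (ω : OSP n d) → DivBlocks d (blocks ω)
    divBlocks ω with isDivOSP-blocks ω
    ... | gbs , bs# , _ = gbs , bs#

    ⋃-blocks : (ω : OSP n d) → ⋃ (blocks ω) ≡ ⊤
    ⋃-blocks ω = proj₂ (proj₂ (isDivOSP-blocks ω))

    fromBlocks-blocks : (ω : OSP n d) → fromBlocks (blocks ω) ≡ just ω
    fromBlocks-blocks (osp bs v) = fromBlocks-valid bs v

    fromBlocks-injective : {bs cs : List (Subset n)} → .(IsDivOSP n d bs) → .(IsDivOSP n d cs) →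
                           fromBlocks bs ≡ fromBlocks cs → bs ≡ cs
    fromBlocks-injective {bs} {cs} v w eq = cong blocks (Maybe.just-injective
      (trans (sym (fromBlocks-valid bs v)) (trans eq (fromBlocks-valid cs w))))

    _≟Ω_ : DecidableEquality (Ω n d)
    _≟Ω_ = Maybe.≡-dec _≟OSP_
      where
      _≟OSP_ : DecidableEquality (OSP n d)
      ψ ≟OSP ω with List.≡-dec _≟ₛ_ (blocks ψ) (blocks ω)
      ... | yes eq    = yes (blocks-injective eq)
      ... | no  ψ≢ω = no (λ eq → ψ≢ω (cong blocks eq))

    ≤Ω-refl : (x : Ω n d) → x ≤Ω x
    ≤Ω-refl nothing  = 0̂≤
    ≤Ω-refl (just ω) = ≤-just ε

    module _ .{{_ : NonZero d}} where

      nblocks≤n/d : (ω : OSP n d) → nblocks ω ≤ n / d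
      nblocks≤n/d ω = subst (_≤ n / d) (m*n/n≡m (nblocks ω) d) (/-monoˡ-≤ d (begin
        nblocks ω ℕ.* d       ≤⟨ length*d≤∣⋃∣ (blocks ω) (divBlocks ω) ⟩
        ∣ ⋃ (blocks ω) ∣      ≡⟨ cong ∣_∣ (⋃-blocks ω) ⟩
        ∣ ⊤ {n} ∣             ≡⟨ ∣⊤∣≡n n ⟩
        n                     ∎))
        where open ℕ.≤-Reasoning

      rk-mono-< : {x y : Ω n d} → x ≤Ω y → x ≢ y → rk x < rk y
      rk-mono-< (0̂≤ {nothing}) x≢y = ⊥-elim (x≢y refl)
      rk-mono-< (0̂≤ {just ω})  _   = ℕ.m<n⇒0<n∸m (s≤s (nblocks≤n/d ω))
      rk-mono-< (≤-just {ψ} {ω} ψ≤ω) x≢y = ℕ.∸-monoʳ-< fewer-blocks (ℕ.m≤n⇒m≤1+n (nblocks≤n/d ψ))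
        where
        D = ≤P⇒≼ ψ≤ω
        fewer-blocks : nblocks ω < nblocks ψ
        fewer-blocks = ℕ.≤∧≢⇒< (≼-length D)
                         (λ eq → x≢y (cong just (blocks-injective (≼-length-≡ D (sym eq)))))

      Enumerates : Ω n d → Ω n d → List (Ω n d) → Set
      Enumerates x y zs = Unique zs × (∀ z → (z ∈ₗ zs) ⇔ ((x ≤Ω z) × (z ≤Ω y)))

      mobius-unique : {μ : Ω n d → Ω n d → ℤ} → IsMobius μ → (x : Ω n d) (g : Ω n d → ℤ) → g x ≡ + 1 →
                      (∀ y → x <Ω y → ∃[ zs ] Enumerates x y zs × sumℤ (map g zs) ≡ + 0) →
                      ∀ y → x ≤Ω y → μ x y ≡ g y
      mobius-unique {μ} (μ-diag , μ-sum) x g gx≡1 g-sums =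
        WF.All.wfRec (On.wellFounded rk <-wellFounded) _ (λ y → x ≤Ω y → μ x y ≡ g y) step
        where
        step : ∀ y → (∀ {z} → rk z < rk y → x ≤Ω z → μ x z ≡ g z) → x ≤Ω y → μ x y ≡ g y
        step y ih x≤y with x ≟Ω y
        ... | yes refl = trans (μ-diag x) (sym gx≡1)
        ... | no  x≢y with g-sums y (x≤y , x≢y)
        ...   | zs , (zs-unique , zs-enum) , Σg≡0 =
          sum-determines-point (μ x) g zs-unique y∈zs agree
            (trans (μ-sum x y (x≤y , x≢y) zs zs-unique zs-enum) (sym Σg≡0))
          where
          y∈zs : y ∈ₗ zs
          y∈zs = Equivalence.from (zs-enum y) (x≤y , ≤Ω-refl y)
          agree : ∀ {z} → z ∈ₗ zs → z ≢ y → μ x z ≡ g z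
          agree {z} z∈zs z≢y with Equivalence.to (zs-enum z) z∈zs
          ... | x≤z , z≤y = ih (rk-mono-< z≤y z≢y) x≤z

  ≼-∷-inv : {x y : Subset n} {xs ys : List (Subset n)} → x ∷ xs ≼ y ∷ ys →
            (y ≡ x × xs ≼ ys) ⊎ ∃[ v ] (y ≡ x ∪ v × xs ≼ v ∷ ys)
  ≼-∷-inv (cut D)  = inj₁ (refl , D)
  ≼-∷-inv (glue D) = inj₂ (_ , refl , D)

  ≼-∪-head : (b : Subset n) {z w : Subset n} {zs ws : List (Subset n)} →
             z ∷ zs ≼ w ∷ ws → b ∪ z ∷ zs ≼ b ∪ w ∷ ws
  ≼-∪-head b E with ≼-∷-inv E
  ... | inj₁ (refl , E′)     = cut E′
  ... | inj₂ (v , refl , E′) = subst (λ c → _ ≼ c ∷ _) (∪-assoc b _ v) (glue E′)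

  ≼-nonempty : {zs ws : List (Subset n)} {w : Subset n} → zs ≼ w ∷ ws → ∃[ z ] ∃[ zs′ ] zs ≡ z ∷ zs′
  ≼-nonempty (cut  D) = _ , _ , refl
  ≼-nonempty (glue D) = _ , _ , refl

  ≼-head-nonempty : ∀ {d} {v : Subset n} {bs xs vs : List (Subset n)} → DivBlocks d bs →
                    bs ≼ xs → xs ≼ v ∷ vs → 0 < ∣ v ∣
  ≼-head-nonempty valid E₁ E₂ with ≼-divBlocks (≼-divBlocks valid E₁) E₂
  ... | (0<v , _) ∷ _ , _ = 0<v

  ≼-head-disjoint : ∀ {d} {b v : Subset n} {bs xs vs : List (Subset n)} → DivBlocks d (b ∷ bs) →
                    bs ≼ xs → xs ≼ v ∷ vs → Disjoint b v
  ≼-head-disjoint {bs = bs} (_ ∷ _ , b# ∷ _) E₁ E₂ =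
    proj₁ (disjoint-∪⁻ (subst (Disjoint _) (trans (≼-⋃ E₁) (≼-⋃ E₂)) (disjoint-⋃⁺ bs b#)))

  ≼-head-grows : ∀ {d} {b v : Subset n} {bs xs vs : List (Subset n)} → DivBlocks d (b ∷ bs) →
                 bs ≼ xs → xs ≼ v ∷ vs → b ∪ v ≢ b
  ≼-head-grows valid@(_ ∷ gbs , _ ∷ bs#) E₁ E₂ =
    p∪q≢p (≼-head-nonempty (gbs , bs#) E₁ E₂) (≼-head-disjoint valid E₁ E₂)

  [p∪q]∪r≢p : {p q r : Subset n} → 0 < ∣ q ∣ → Disjoint p q → (p ∪ q) ∪ r ≢ p
  [p∪q]∪r≢p {p = p} {q} {r} 0<q pq [p∪q]∪r≡p = p∪q≢p 0<q pq (⊆-antisym p∪q⊆p (p⊆p∪q q))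
    where
    p∪q⊆p : p ∪ q ⊆ p
    p∪q⊆p x∈ = subst (_ ∈_) [p∪q]∪r≡p (p⊆p∪q r x∈)

  -- Intervals above an ordered set partition

  glueHead : Subset n → List (Subset n) → List (Subset n)
  glueHead b []       = []
  glueHead b (z ∷ zs) = b ∪ z ∷ zs

  -- The lists zs with bs ≼ zs ≼ ws: at each glue of D, the block b either stays alone in zs or is
  -- glued to its successor (which always exists, so the [] case of glueHead is never used).
  between : {bs ws : List (Subset n)} → bs ≼ ws → List (List (Subset n))
  between []               = [ [] ]
  between (cut  {b = b} D) = map (b ∷_) (between D)
  between (glue {b = b} D) = map (b ∷_) (between D) ++ map (glueHead b) (between D)

  between-sound : {bs ws zs : List (Subset n)} (D : bs ≼ ws) → zs ∈ₗ between D → bs ≼ zs × zs ≼ ws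
  between-sound [] (here refl) = [] , []
  between-sound (cut D) zs∈ with ∈-map⁻ _ zs∈
  ... | _ , zs′∈ , refl with between-sound D zs′∈
  ...   | E₁ , E₂ = cut E₁ , cut E₂
  between-sound (glue {b = b} D) zs∈ with ∈-++⁻ (map (b ∷_) (between D)) zs∈
  ... | inj₁ zs∈ˡ with ∈-map⁻ _ zs∈ˡ
  ...   | _ , zs′∈ , refl with between-sound D zs′∈
  ...     | E₁ , E₂ = cut E₁ , glue E₂
  between-sound (glue {b = b} D) zs∈ | inj₂ zs∈ʳ with ∈-map⁻ _ zs∈ʳ
  ...   | _ , zs′∈ , refl with between-sound D zs′∈
  ...     | E₁ , E₂ with ≼-nonempty E₂
  ...       | _ , _ , refl = glue E₁ , ≼-∪-head b E₂

  between-complete : ∀ {d} {bs ws zs : List (Subset n)} → DivBlocks d bs → (D : bs ≼ ws) →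
                     bs ≼ zs → zs ≼ ws → zs ∈ₗ between D
  between-complete _ [] [] [] = here refl
  between-complete valid@(_ ∷ gbs , _ ∷ bs#) (cut D) (cut E₁) E₂ with ≼-∷-inv E₂
  ... | inj₁ (_ , E₂′)          = ∈-map⁺ _ (between-complete (gbs , bs#) D E₁ E₂′)
  ... | inj₂ (_ , b≡b∪v , E₂′) = ⊥-elim (≼-head-grows valid E₁ E₂′ (sym b≡b∪v))
  between-complete valid@(_ ∷ gbs , _ ∷ bs#) (cut D) (glue E₁) E₂ with ≼-∷-inv E₂
  ... | inj₁ (b≡b∪u , _)          = ⊥-elim (≼-head-grows valid (≼-refl _) E₁ (sym b≡b∪u))
  ... | inj₂ (_ , b≡[b∪u]∪v , _) = ⊥-elim ([p∪q]∪r≢p (≼-head-nonempty (gbs , bs#) (≼-refl _) E₁)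
                                                     (≼-head-disjoint valid (≼-refl _) E₁) (sym b≡[b∪u]∪v))
  between-complete valid@(_ ∷ gbs , _ ∷ bs#) (glue D) (cut E₁) E₂ with ≼-∷-inv E₂
  ... | inj₁ (b∪w≡b , _)          = ⊥-elim (≼-head-grows valid (≼-refl _) D b∪w≡b)
  ... | inj₂ (_ , b∪w≡b∪v , E₂′) =
    ∈-++⁺ˡ (∈-map⁺ _ (between-complete (gbs , bs#) D E₁ (subst (λ c → _ ≼ c ∷ _) (sym w≡v) E₂′)))
    where
    w≡v = ∪-cancelˡ (≼-head-disjoint valid (≼-refl _) D) (≼-head-disjoint valid E₁ E₂′) b∪w≡b∪v
  between-complete {bs = b ∷ _} valid@(_ ∷ gbs , _ ∷ bs#) (glue D) (glue {w = u} E₁) E₂ with ≼-∷-inv E₂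
  ... | inj₁ (b∪w≡b∪u , E₂′) =
    ∈-++⁺ʳ (map (b ∷_) (between D))
      (∈-map⁺ (glueHead b) (between-complete (gbs , bs#) D E₁ (subst (λ c → _ ≼ c ∷ _) u≡w (cut E₂′))))
    where
    u≡w = ∪-cancelˡ (≼-head-disjoint valid (≼-refl _) E₁) (≼-head-disjoint valid (≼-refl _) D) (sym b∪w≡b∪u)
  ... | inj₂ (v , b∪w≡[b∪u]∪v , E₂′) =
    ∈-++⁺ʳ (map (b ∷_) (between D))
      (∈-map⁺ (glueHead b)
        (between-complete (gbs , bs#) D E₁ (subst (λ c → _ ≼ c ∷ _) (sym w≡u∪v) (glue E₂′))))
    where
    w≡u∪v = ∪-cancelˡ (≼-head-disjoint valid (≼-refl _) D) (≼-head-disjoint valid E₁ (glue {b = u} E₂′))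
                      (trans b∪w≡[b∪u]∪v (∪-assoc b u v))

  between-unique : ∀ {d} {bs ws : List (Subset n)} → DivBlocks d bs → (D : bs ≼ ws) → Unique (between D)
  between-unique _ [] = [] ∷ []
  between-unique (_ ∷ gbs , _ ∷ bs#) (cut D) = Unique.map⁺ List.∷-injectiveʳ (between-unique (gbs , bs#) D)
  between-unique {bs = b ∷ bs} valid@(_ ∷ gbs , _ ∷ bs#) (glue D) =
    Unique.++⁺ (Unique.map⁺ List.∷-injectiveʳ unique) (unique-map⁺ (glueHead b) glueHead-injective unique)
      λ (zs∈ˡ , zs∈ʳ) → cut≢glue (∈-map⁻ _ zs∈ˡ) (∈-map⁻ _ zs∈ʳ)
    where
    unique = between-unique (gbs , bs#) D
    head-facts : ∀ {zs} → zs ∈ₗ between D → ∃[ z ] ∃[ zs′ ] zs ≡ z ∷ zs′ × Disjoint b z × 0 < ∣ z ∣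
    head-facts zs∈ with between-sound D zs∈
    ... | E₁ , E₂ with ≼-nonempty E₂
    ...   | _ , _ , refl =
      _ , _ , refl , ≼-head-disjoint valid E₁ (≼-refl _) , ≼-head-nonempty (gbs , bs#) E₁ (≼-refl _)
    glueHead-injective : ∀ {zs zs′} → zs ∈ₗ between D → zs′ ∈ₗ between D →
                         glueHead b zs ≡ glueHead b zs′ → zs ≡ zs′
    glueHead-injective zs∈ zs′∈ eq with head-facts zs∈ | head-facts zs′∈
    ... | _ , _ , refl , bz , _ | _ , _ , refl , bz′ , _ with List.∷-injective eq
    ...   | b∪z≡b∪z′ , refl = cong (_∷ _) (∪-cancelˡ bz bz′ b∪z≡b∪z′)
    cut≢glue : ∀ {ys} → ∃[ zs ] zs ∈ₗ between D × ys ≡ b ∷ zs →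
               ¬ (∃[ zs′ ] zs′ ∈ₗ between D × ys ≡ glueHead b zs′)
    cut≢glue (_ , _ , refl) (zs′ , zs′∈ , eq) with head-facts zs′∈
    ... | _ , _ , refl , bz′ , 0<z′ = p∪q≢p 0<z′ bz′ (sym (List.∷-injectiveˡ eq))

  between-alternating : {bs ws : List (Subset n)} (D : bs ≼ ws) → bs ≢ ws →
                        sumℤ (map (λ zs → -1ℤ ^ (length bs ∸ length zs)) (between D)) ≡ + 0
  between-alternating []                     bs≢ws = ⊥-elim (bs≢ws refl)
  between-alternating {bs = b ∷ _} (cut D)  bs≢ws =
    trans (cong sumℤ (sym (List.map-∘ (between D)))) (between-alternating D (bs≢ws ∘ cong (b ∷_)))
  between-alternating {bs = b ∷ bs} (glue D) _ = begin
    sumℤ (map sign′ (map (b ∷_) (between D) ++ map (glueHead b) (between D)))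
      ≡⟨ sum-map-++ sign′ (map (b ∷_) (between D)) _ ⟩
    sumℤ (map sign′ (map (b ∷_) (between D))) + sumℤ (map sign′ (map (glueHead b) (between D)))
      ≡⟨ cong₂ _+_ (cong sumℤ (sym (List.map-∘ (between D))))
                   (trans (cong sumℤ (sym (List.map-∘ (between D)))) (sum-cong glued-flips)) ⟩
    S + sumℤ (map (λ zs → -1ℤ * sign zs) (between D))
      ≡⟨ cong (_+_ S) (trans (sum-*ˡ -1ℤ sign (between D)) (ℤ.-1*i≡-i S)) ⟩
    S - S
      ≡⟨ ℤ.+-inverseʳ S ⟩
    + 0 ∎
    where
    open ≡-Reasoning
    sign sign′ : List (Subset n) → ℤ
    sign  zs = -1ℤ ^ (length bs ∸ length zs)
    sign′ zs = -1ℤ ^ (suc (length bs) ∸ length zs)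
    S = sumℤ (map sign (between D))
    glued-flips : ∀ {zs} → zs ∈ₗ between D → sign′ (glueHead b zs) ≡ -1ℤ * sign zs
    glued-flips zs∈ with between-sound D zs∈
    ... | E₁ , E₂ with ≼-nonempty E₂
    ...   | _ , _ , refl = cong (-1ℤ ^_) (ℕ.+-∸-assoc 1 (≼-length E₁))

  [m∸o]∸[m∸n]≡n∸o : ∀ {m n o} → o ≤ n → n ≤ m → (m ∸ o) ∸ (m ∸ n) ≡ n ∸ o
  [m∸o]∸[m∸n]≡n∸o {m} {n} {o} o≤n n≤m = begin
    (m ∸ o) ∸ (m ∸ n)                 ≡⟨ cong (λ k → (k ∸ o) ∸ (m ∸ n)) (sym (ℕ.m∸n+n≡m n≤m)) ⟩
    ((m ∸ n) ℕ.+ n ∸ o) ∸ (m ∸ n)     ≡⟨ cong (_∸ (m ∸ n)) (ℕ.+-∸-assoc (m ∸ n) o≤n) ⟩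
    ((m ∸ n) ℕ.+ (n ∸ o)) ∸ (m ∸ n)   ≡⟨ ℕ.m+n∸m≡n (m ∸ n) (n ∸ o) ⟩
    n ∸ o                             ∎
    where open ≡-Reasoning

  module _ {n d : ℕ} .{{_ : NonZero d}} (ψ ω : OSP n d) (ψ≤ω : ψ ≤P ω) where

    private
      D = ≤P⇒≼ ψ≤ω
      between-valid : ∀ {zs} → zs ∈ₗ between D → IsDivOSP n d zs
      between-valid zs∈ = ≼-isDivOSP (isDivOSP-blocks ψ) (proj₁ (between-sound D zs∈))

    interval : List (Ω n d)
    interval = map fromBlocks (between D)

    interval-enumerates : Enumerates (just ψ) (just ω) interval
    interval-enumerates = unique , λ z → mk⇔ (to z) from
      where
      unique : Unique interval
      unique = unique-map⁺ fromBlocks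
        (λ zs∈ zs′∈ → fromBlocks-injective (between-valid zs∈) (between-valid zs′∈))
        (between-unique (divBlocks ψ) D)
      to : ∀ z → z ∈ₗ interval → just ψ ≤Ω z × z ≤Ω just ω
      to z z∈ with ∈-map⁻ fromBlocks z∈
      ... | zs , zs∈ , refl rewrite fromBlocks-valid zs (between-valid zs∈) with between-sound D zs∈
      ...   | E₁ , E₂ = ≤-just (≼⇒≤P ψ χ E₁) , ≤-just (≼⇒≤P χ ω E₂)
        where χ = osp zs (between-valid zs∈)
      from : ∀ {z} → just ψ ≤Ω z × z ≤Ω just ω → z ∈ₗ interval
      from (≤-just {ω = χ} ψ≤χ , ≤-just χ≤ω) = subst (_∈ₗ interval) (fromBlocks-blocks χ)
        (∈-map⁺ fromBlocks (between-complete (divBlocks ψ) D (≤P⇒≼ ψ≤χ) (≤P⇒≼ χ≤ω)))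

    interval-alternating : ψ ≢ ω → sumℤ (map (λ z → -1ℤ ^ rkI (just ψ) z) interval) ≡ + 0
    interval-alternating ψ≢ω = begin
      sumℤ (map (λ z → -1ℤ ^ rkI (just ψ) z) (map fromBlocks (between D)))
        ≡⟨ cong sumℤ (sym (List.map-∘ (between D))) ⟩
      sumℤ (map (λ zs → -1ℤ ^ rkI (just ψ) (fromBlocks zs)) (between D))
        ≡⟨ sum-cong rank-difference ⟩
      sumℤ (map (λ zs → -1ℤ ^ (nblocks ψ ∸ length zs)) (between D))
        ≡⟨ between-alternating D (ψ≢ω ∘ blocks-injective) ⟩
      + 0 ∎
      where
      open ≡-Reasoning
      rank-difference : ∀ {zs} → zs ∈ₗ between D →
                        -1ℤ ^ rkI (just ψ) (fromBlocks zs) ≡ -1ℤ ^ (nblocks ψ ∸ length zs)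
      rank-difference {zs} zs∈ rewrite fromBlocks-valid zs (between-valid zs∈) =
        cong (-1ℤ ^_) ([m∸o]∸[m∸n]≡n∸o (≼-length (proj₁ (between-sound D zs∈)))
                                        (ℕ.m≤n⇒m≤1+n (nblocks≤n/d ψ)))

  module _ {n d : ℕ} .{{_ : NonZero d}} where

    mobius-interval : {μ : Ω n d → Ω n d → ℤ} → IsMobius μ → (ψ ω : OSP n d) → just ψ ≤Ω just ω →
                      μ (just ψ) (just ω) ≡ -1ℤ ^ rkI (just ψ) (just ω)
    mobius-interval isM ψ ω =
      mobius-unique isM (just ψ) (λ z → -1ℤ ^ rkI (just ψ) z) (cong (-1ℤ ^_) (ℕ.n∸n≡0 (rk (just ψ))))
                    sums (just ω)
      where
      sums : ∀ y → just ψ <Ω y →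
             ∃[ zs ] Enumerates (just ψ) y zs × sumℤ (map (λ z → -1ℤ ^ rkI (just ψ) z) zs) ≡ + 0
      sums (just χ) (≤-just ψ≤χ , ψ≢χ) =
        interval ψ χ ψ≤χ , interval-enumerates ψ χ ψ≤χ , interval-alternating ψ χ ψ≤χ (ψ≢χ ∘ cong just)

  -- Intervals above 0̂

  consNonempty : Subset n → List (Subset n) → List (Subset n)
  consNonempty c cs with c ≟ₛ ⊥
  ... | yes _ = cs
  ... | no  _ = c ∷ cs

  consNonempty-⊥ : {c : Subset n} (cs : List (Subset n)) → c ≡ ⊥ → consNonempty c cs ≡ cs
  consNonempty-⊥ {c = c} cs c≡⊥ with c ≟ₛ ⊥
  ... | yes _   = refl
  ... | no  c≢⊥ = ⊥-elim (c≢⊥ c≡⊥)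

  consNonempty-≢⊥ : {c : Subset n} (cs : List (Subset n)) → c ≢ ⊥ → consNonempty c cs ≡ c ∷ cs
  consNonempty-≢⊥ {c = c} cs c≢⊥ with c ≟ₛ ⊥
  ... | yes c≡⊥ = ⊥-elim (c≢⊥ c≡⊥)
  ... | no  _   = refl

  module _ (d : ℕ) where

    goodSubsets : Subset n → List (Subset n)
    goodSubsets b = filter (λ v → goodSize? d ∣ v ∣) (subsets b)

    ∈-goodSubsets⁺ : {v b : Subset n} → v ⊆ b → GoodSize d ∣ v ∣ → v ∈ₗ goodSubsets b
    ∈-goodSubsets⁺ v⊆b good-v = ∈-filter⁺ (λ v → goodSize? d ∣ v ∣) (∈-subsets⁺ v⊆b) good-v

    ∈-goodSubsets⁻ : {v b : Subset n} → v ∈ₗ goodSubsets b → v ⊆ b × GoodSize d ∣ v ∣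
    ∈-goodSubsets⁻ {b = b} v∈ with ∈-filter⁻ (λ v → goodSize? d ∣ v ∣) {xs = subsets b} v∈
    ... | v∈subsets , good-v = ∈-subsets⁻ v∈subsets , good-v

    -- The refinements of bs into at most k blocks of good size: the first block v ⊆ b is chosen, and
    -- b ─ v, if nonempty, is refined together with the remaining blocks.
    refinements : ℕ → List (Subset n) → List (List (Subset n))
    startingWith : ℕ → Subset n → List (Subset n) → Subset n → List (List (Subset n))

    refinements _       []       = [ [] ]
    refinements zero    (_ ∷ _)  = []
    refinements (suc k) (b ∷ bs) = concatMap (startingWith k b bs) (goodSubsets b)

    startingWith k b bs v = map (v ∷_) (refinements k (consNonempty (b ─ v) bs))

    refinements-sound : ∀ k {bs zs : List (Subset n)} → AllPairs Disjoint bs → zs ∈ₗ refinements k bs →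
                        zs ≼ bs × DivBlocks d zs
    startingWith-sound : ∀ k {v b : Subset n} {bs zs : List (Subset n)} → AllPairs Disjoint (b ∷ bs) →
                         v ⊆ b → GoodSize d ∣ v ∣ → zs ∈ₗ refinements k (consNonempty (b ─ v) bs) →
                         v ∷ zs ≼ b ∷ bs × DivBlocks d (v ∷ zs)

    refinements-sound _       {[]}     []    (here refl) = [] , [] , []
    refinements-sound (suc k) {b ∷ bs} b∷bs# zs∈
      with Mem.find (∈-concatMap⁻ (startingWith k b bs) {xs = goodSubsets b} zs∈)
    ... | v , v∈ , zs∈′ with ∈-goodSubsets⁻ {b = b} v∈ | map∷⁻ zs∈′
    ...   | v⊆b , good-v | _ , zs′∈ , refl = startingWith-sound k b∷bs# v⊆b good-v zs′∈

    startingWith-sound k {v} {b} {bs} {zs} (b# ∷ bs#) v⊆b good-v zs∈ with b ─ v ≟ₛ ⊥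
    ... | yes b─v≡⊥ with refinements-sound k bs# zs∈
    ...   | E , gzs , zs# = subst (λ c → c ∷ zs ≼ b ∷ bs) (sym v≡b) (cut E) , good-v ∷ gzs , v#zs ∷ zs#
      where
      v≡b : v ≡ b
      v≡b = p⊆q∧q─p≡⊥⇒p≡q v⊆b b─v≡⊥
      v#zs : All (Disjoint v) zs
      v#zs = disjoint-⋃⁻ zs (subst₂ Disjoint (sym v≡b) (sym (≼-⋃ E)) (disjoint-⋃⁺ bs b#))
    startingWith-sound k {v} {b} {bs} {zs} (b# ∷ bs#) v⊆b good-v zs∈ | no _
      with refinements-sound k (All.map (disjoint-⊆ˡ (p─q⊆p b v)) b# ∷ bs#) zs∈
    ...   | E , gzs , zs# =
      subst (λ c → v ∷ zs ≼ c ∷ bs) (p⊆q⇒p∪[q─p]≡q v⊆b) (glue E) , good-v ∷ gzs , v#zs ∷ zs#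
      where
      v#zs : All (Disjoint v) zs
      v#zs = disjoint-⋃⁻ zs (subst (Disjoint v) (sym (≼-⋃ E))
               (disjoint-∪⁺ (disjoint-─ b v) (disjoint-⊆ˡ v⊆b (disjoint-⋃⁺ bs b#))))

    refinements-complete : ∀ k {bs zs : List (Subset n)} → DivBlocks d zs → zs ≼ bs → length zs ≤ k →
                           zs ∈ₗ refinements k bs
    refinements-complete _       _ [] _ = here refl
    refinements-complete {n} (suc k) {b ∷ bs} {t ∷ zs} valid@(gt ∷ gzs , _ ∷ zs#) E (s≤s len≤k)
      with ≼-∷-inv E
    ... | inj₁ (refl , E′) =
      ∈-concatMap⁺ (startingWith k t bs) (Mem.lose (∈-goodSubsets⁺ ⊆-refl gt)
        (∈-map⁺ (t ∷_) (subst (λ cs → zs ∈ₗ refinements k cs) (sym (consNonempty-⊥ bs (p─p≡⊥ t)))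
          (refinements-complete k (gzs , zs#) E′ len≤k))))
    ... | inj₂ (u , refl , E′) =
      ∈-concatMap⁺ (startingWith k (t ∪ u) bs) (Mem.lose (∈-goodSubsets⁺ (p⊆p∪q u) gt)
        (∈-map⁺ (t ∷_) (subst (λ cs → zs ∈ₗ refinements k cs) (sym rest≡)
          (refinements-complete k (gzs , zs#) E′ len≤k))))
      where
      u≢⊥ : u ≢ ⊥
      u≢⊥ u≡⊥ = ℕ.<-irrefl (trans (sym (∣⊥∣≡0 n)) (cong ∣_∣ (sym u≡⊥)))
                           (≼-head-nonempty (gzs , zs#) (≼-refl zs) E′)
      rest≡ : consNonempty ((t ∪ u) ─ t) bs ≡ u ∷ bs
      rest≡ = trans (cong (λ c → consNonempty c bs) ([p∪q]─p≡q t u (≼-head-disjoint valid (≼-refl zs) E′)))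
                    (consNonempty-≢⊥ bs u≢⊥)

    refinements-unique : ∀ k (bs : List (Subset n)) → Unique (refinements k bs)
    refinements-unique _       []       = [] ∷ []
    refinements-unique zero    (_ ∷ _)  = []
    refinements-unique (suc k) (b ∷ bs) =
      unique-concatMap _ (Unique.filter⁺ (λ v → goodSize? d ∣ v ∣) (subsets-unique b))
        (λ {v} _ → Unique.map⁺ List.∷-injectiveʳ (refinements-unique k (consNonempty (b ─ v) bs)))
        heads-agree
      where
      heads-agree : ∀ {v w zs} → v ∈ₗ goodSubsets b → w ∈ₗ goodSubsets b →
                    zs ∈ₗ startingWith k b bs v → zs ∈ₗ startingWith k b bs w → v ≡ w
      heads-agree _ _ zs∈v zs∈w with map∷⁻ zs∈v | map∷⁻ zs∈w
      ... | _ , _ , refl | _ , _ , eq = List.∷-injectiveˡ eq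

    weight : List (Subset n) → ℤ
    weight zs = -1ℤ ^ length zs * productℤ (map (λ c → euler d ∣ c ∣) zs)

    weight-∷ : (c : Subset n) (zs : List (Subset n)) → weight (c ∷ zs) ≡ (-1ℤ * euler d ∣ c ∣) * weight zs
    weight-∷ c zs = regroup (-1ℤ ^ length zs) (euler d ∣ c ∣) (productℤ (map (λ c → euler d ∣ c ∣) zs))
      where
      regroup : ∀ s e p → (- + 1 * s) * (e * p) ≡ (- + 1 * e) * (s * p)
      regroup = solve-∀

    remainder-valid : ∀ {k} {v b : Subset n} {bs : List (Subset n)} → v ⊆ b → GoodSize d ∣ v ∣ →
                      DivBlocks d (b ∷ bs) → size (b ∷ bs) ≤ suc k →
                      DivBlocks d (consNonempty (b ─ v) bs) × size (consNonempty (b ─ v) bs) ≤ k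
    remainder-valid {k = k} {v = v} {b = b} {bs = bs} v⊆b (0<v , d∣v) (gb ∷ gbs , b# ∷ bs#) size≤
      with b ─ v ≟ₛ ⊥
    ... | yes _   = (gbs , bs#) , ℕ.≤-pred (ℕ.≤-trans (ℕ.+-monoˡ-≤ (size bs) (proj₁ gb)) size≤)
    ... | no  b─v≢⊥ =
      ((0<b─v , ∣m+n∣m⇒∣n (subst (d ∣_) (sym |v|+|b─v|≡|b|) (proj₂ gb)) d∣v) ∷ gbs ,
       All.map (disjoint-⊆ˡ (p─q⊆p b v)) b# ∷ bs#) ,
      ℕ.≤-pred (ℕ.≤-trans (ℕ.+-monoˡ-< (size bs) |b─v|<|b|) size≤)
      where
      0<b─v : 0 < ∣ b ─ v ∣
      0<b─v = ℕ.n≢0⇒n>0 (b─v≢⊥ ∘ ∣p∣≡0⇒p≡⊥ (b ─ v))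
      |v|+|b─v|≡|b| : ∣ v ∣ ℕ.+ ∣ b ─ v ∣ ≡ ∣ b ∣
      |v|+|b─v|≡|b| = trans (sym (∣p∪q∣≡∣p∣+∣q∣ v (b ─ v) (disjoint-─ b v))) (cong ∣_∣ (p⊆q⇒p∪[q─p]≡q v⊆b))
      |b─v|<|b| : ∣ b ─ v ∣ < ∣ b ∣
      |b─v|<|b| = subst (∣ b ─ v ∣ <_) |v|+|b─v|≡|b| (ℕ.m<n+m ∣ b ─ v ∣ 0<v)

    refinements-weight : ∀ k {bs : List (Subset n)} → DivBlocks d bs → size bs ≤ k →
                         sumℤ (map weight (refinements k bs)) ≡ + 1
    refinements-weight _       {[]}     _                        _     = refl
    refinements-weight zero    {b ∷ bs} ((0<b , _) ∷ _ , _)     size≤ =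
      ⊥-elim (ℕ.<-irrefl refl (ℕ.<-≤-trans 0<b (ℕ.≤-trans (ℕ.m≤m+n ∣ b ∣ (size bs)) size≤)))
    refinements-weight (suc k) {b ∷ bs} valid@((0<b , d∣b) ∷ _ , _) size≤ = begin
      sumℤ (map weight (concatMap (startingWith k b bs) (goodSubsets b)))
        ≡⟨ sum-concatMap (startingWith k b bs) weight (goodSubsets b) ⟩
      sumℤ (map (λ v → sumℤ (map weight (startingWith k b bs v))) (goodSubsets b))
        ≡⟨ sum-cong first-block-weight ⟩
      sumℤ (map (λ v → -1ℤ * euler d ∣ v ∣) (goodSubsets b))
        ≡⟨ sum-*ˡ -1ℤ (λ v → euler d ∣ v ∣) (goodSubsets b) ⟩
      -1ℤ * sumℤ (map (λ v → euler d ∣ v ∣) (goodSubsets b))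
        ≡⟨ cong (-1ℤ *_) (sum-filter (λ v → goodSize? d ∣ v ∣) (λ v → euler d ∣ v ∣) (subsets b)) ⟩
      -1ℤ * sumℤ (map (λ v → onGoodSizes d ∣ v ∣ (euler d ∣ v ∣)) (subsets b))
        ≡⟨ cong (-1ℤ *_) (sum-subsets b (λ i _ → onGoodSizes d i (euler d i))) ⟩
      -1ℤ * splitSum ∣ b ∣ (λ i _ → onGoodSizes d i (euler d i))
        ≡⟨ cong (-1ℤ *_) (euler-splitSum d ∣ b ∣ 0<b d∣b) ⟩
      + 1 ∎
      where
      open ≡-Reasoning
      first-block-weight : ∀ {v} → v ∈ₗ goodSubsets b →
                           sumℤ (map weight (startingWith k b bs v)) ≡ -1ℤ * euler d ∣ v ∣
      first-block-weight {v} v∈ with ∈-goodSubsets⁻ v∈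
      ... | v⊆b , good-v with remainder-valid v⊆b good-v valid size≤
      ...   | rest-valid , rest-size≤ = begin
        sumℤ (map weight (map (v ∷_) R))
          ≡⟨ cong sumℤ (sym (List.map-∘ R)) ⟩
        sumℤ (map (λ zs → weight (v ∷ zs)) R)
          ≡⟨ sum-cong {xs = R} (λ {zs} _ → weight-∷ v zs) ⟩
        sumℤ (map (λ zs → (-1ℤ * euler d ∣ v ∣) * weight zs) R)
          ≡⟨ sum-*ˡ (-1ℤ * euler d ∣ v ∣) weight R ⟩
        (-1ℤ * euler d ∣ v ∣) * sumℤ (map weight R)
          ≡⟨ cong ((-1ℤ * euler d ∣ v ∣) *_) (refinements-weight k rest-valid rest-size≤) ⟩
        (-1ℤ * euler d ∣ v ∣) * + 1
          ≡⟨ ℤ.*-identityʳ _ ⟩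
        -1ℤ * euler d ∣ v ∣ ∎
        where R = refinements k (consNonempty (b ─ v) bs)

  module _ {n d : ℕ} .{{_ : NonZero d}} where

    μ₀-formula : Ω n d → ℤ
    μ₀-formula nothing  = + 1
    μ₀-formula (just ω) = - weight d (blocks ω)

    module _ (ω : OSP n d) where

      private
        R = refinements d n (blocks ω)
        refinement-valid : ∀ {zs} → zs ∈ₗ R → IsDivOSP n d zs
        refinement-valid zs∈ with refinements-sound d n (proj₂ (divBlocks ω)) zs∈
        ... | E , gzs , zs# = gzs , zs# , trans (≼-⋃ E) (⋃-blocks ω)

      lowerInterval : List (Ω n d)
      lowerInterval = nothing ∷ map fromBlocks R

      lowerInterval-enumerates : Enumerates 0̂ (just ω) lowerInterval
      lowerInterval-enumerates = unique , λ z → mk⇔ (to z) from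
        where
        0̂≢fromBlocks : ∀ {zs} → zs ∈ₗ R → 0̂ ≢ fromBlocks zs
        0̂≢fromBlocks zs∈ 0̂≡ with trans 0̂≡ (fromBlocks-valid _ (refinement-valid zs∈))
        ... | ()
        unique : Unique lowerInterval
        unique = All-map⁺ (All.tabulate 0̂≢fromBlocks)
               ∷ unique-map⁺ fromBlocks
                   (λ zs∈ zs′∈ → fromBlocks-injective (refinement-valid zs∈) (refinement-valid zs′∈))
                   (refinements-unique d n (blocks ω))
        to : ∀ z → z ∈ₗ lowerInterval → 0̂ ≤Ω z × z ≤Ω just ω
        to _ (here refl) = 0̂≤ , 0̂≤
        to z (there z∈) with ∈-map⁻ fromBlocks z∈
        ... | zs , zs∈ , refl rewrite fromBlocks-valid zs (refinement-valid zs∈) =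
          0̂≤ , ≤-just (≼⇒≤P (osp zs (refinement-valid zs∈)) ω
                             (proj₁ (refinements-sound d n (proj₂ (divBlocks ω)) zs∈)))
        from : ∀ {z} → 0̂ ≤Ω z × z ≤Ω just ω → z ∈ₗ lowerInterval
        from (_ , 0̂≤)                 = here refl
        from (_ , ≤-just {ψ = χ} χ≤ω) = there (subst (_∈ₗ map fromBlocks R) (fromBlocks-blocks χ)
          (∈-map⁺ fromBlocks (refinements-complete d n (divBlocks χ) (≤P⇒≼ χ≤ω)
            (ℕ.≤-trans (nblocks≤n/d χ) (m/n≤m n d)))))

      lowerInterval-sum : sumℤ (map μ₀-formula lowerInterval) ≡ + 0
      lowerInterval-sum = cong (_+_ (+ 1)) (begin
        sumℤ (map μ₀-formula (map fromBlocks R))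
          ≡⟨ cong sumℤ (sym (List.map-∘ R)) ⟩
        sumℤ (map (μ₀-formula ∘ fromBlocks) R)
          ≡⟨ sum-cong (λ {zs} zs∈ → trans (cong μ₀-formula (fromBlocks-valid zs (refinement-valid zs∈)))
                                            (sym (ℤ.-1*i≡-i (weight d zs)))) ⟩
        sumℤ (map (λ zs → -1ℤ * weight d zs) R)
          ≡⟨ sum-*ˡ -1ℤ (weight d) R ⟩
        -1ℤ * sumℤ (map (weight d) R)
          ≡⟨ cong (-1ℤ *_) (refinements-weight d n (divBlocks ω) (ℕ.≤-reflexive size≡n)) ⟩
        -1ℤ ∎)
        where
        open ≡-Reasoning
        size≡n : size (blocks ω) ≡ n
        size≡n = trans (size≡∣⋃∣ (blocks ω) (proj₂ (divBlocks ω))) (trans (cong ∣_∣ (⋃-blocks ω)) (∣⊤∣≡n n))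

    mobius-0̂ : {μ : Ω n d → Ω n d → ℤ} → IsMobius μ → (ω : OSP n d) → μ 0̂ (just ω) ≡ - weight d (blocks ω)
    mobius-0̂ isM ω = mobius-unique isM 0̂ μ₀-formula refl sums (just ω) 0̂≤
      where
      sums : ∀ y → 0̂ <Ω y → ∃[ zs ] Enumerates 0̂ y zs × sumℤ (map μ₀-formula zs) ≡ + 0
      sums nothing  (_ , 0̂≢0̂) = ⊥-elim (0̂≢0̂ refl)
      sums (just χ) _          = lowerInterval χ , lowerInterval-enumerates χ , lowerInterval-sum χ

  toℚ-product-euler : ∀ d (bs : List (Subset n)) →
                      toℚ (productℤ (map (λ c → euler d ∣ c ∣) bs)) ≡ prodℚ (map (λ b → 𝓔 d ∣ b ∣) bs)
  toℚ-product-euler d []       = refl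
  toℚ-product-euler d (b ∷ bs) =
    trans (toℚ-* (euler d ∣ b ∣) _) (cong₂ ℚ._*_ (toℚ-euler d ∣ b ∣) (toℚ-product-euler d bs))

  toℚ-neg-weight : ∀ d (bs : List (Subset n)) →
                   toℚ (- weight d bs) ≡ toℚ (- (-1ℤ ^ length bs)) ℚ.* prodℚ (map (λ b → 𝓔 d ∣ b ∣) bs)
  toℚ-neg-weight d bs = begin
    toℚ (- (-1ℤ ^ length bs * productℤ E))
      ≡⟨ cong toℚ (ℤ.neg-distribˡ-* (-1ℤ ^ length bs) _) ⟩
    toℚ (- (-1ℤ ^ length bs) * productℤ E)
      ≡⟨ toℚ-* (- (-1ℤ ^ length bs)) _ ⟩
    toℚ (- (-1ℤ ^ length bs)) ℚ.* toℚ (productℤ E)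
      ≡⟨ cong (toℚ (- (-1ℤ ^ length bs)) ℚ.*_) (toℚ-product-euler d bs) ⟩
    toℚ (- (-1ℤ ^ length bs)) ℚ.* prodℚ (map (λ b → 𝓔 d ∣ b ∣) bs) ∎
    where
    open ≡-Reasoning
    E = map (λ c → euler d ∣ c ∣) bs

  top-isDivOSP : ∀ {n d} → 0 < n → d ∣ n → IsDivOSP n d (⊤ ∷ [])
  top-isDivOSP {n} {d} 0<n d∣n =
    (subst (GoodSize d) (sym (∣⊤∣≡n n)) (0<n , d∣n) ∷ []) , [] ∷ [] , ∪-identityʳ ⊤

open import Defs
open import Data.Nat using (ℕ; _<_; _∸_; NonZero)
open import Data.Nat.Divisibility using (_∣_)
open import Data.Integer using (ℤ; -_; _^_; +_)
open import Data.Rational using (_*_)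
open import Data.List using (map)
open import Data.Fin.Subset using (∣_∣)
open import Data.Maybe using (just; nothing)
open import Data.Product using (_×_)
open import Relation.Binary.PropositionalEquality using (_≡_)
open import Data.Fin.Subset using (⊤)
open import Data.Fin.Subset.Properties using (∣⊤∣≡n)
open import Data.List using ([]; _∷_)
open import Data.Product using (_,_)
import Data.Rational.Properties as ℚ
open import Relation.Binary.PropositionalEquality using (cong; trans)
open OrderedSetPartitionPoset using (mobius-interval; mobius-0̂; toℚ-neg-weight; top-isDivOSP)

mainTheorem2 : (d n : ℕ) .{{_ : NonZero d}} → (d∣n : d ∣ n)
  → (μ : Ω n d → Ω n d → ℤ) → IsMobius μ
  → ((ψ ω : OSP n d) → just ψ ≤Ω just ω
      → μ (just ψ) (just ω) ≡ (- (+ 1)) ^ rkI (just ψ) (just ω))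
    × ((0<n : 0 < n)
      → toℚ (μ nothing (1̂ n d 0<n d∣n)) ≡ 𝓔 d n)
    × ((ω : OSP n d)
      → toℚ (μ nothing (just ω))
        ≡ toℚ (- ((- (+ 1)) ^ nblocks ω)) * prodℚ (map (λ b → 𝓔 d ∣ b ∣) (blocks ω)))
mainTheorem2 d n d∣n μ isM = mobius-interval isM , part-b , part-c
  where
  part-c : (ω : OSP n d) → toℚ (μ nothing (just ω))
           ≡ toℚ (- ((- (+ 1)) ^ nblocks ω)) * prodℚ (map (λ b → 𝓔 d ∣ b ∣) (blocks ω))
  part-c ω = trans (cong toℚ (mobius-0̂ isM ω)) (toℚ-neg-weight d (blocks ω))
  part-b : (0<n : 0 < n) → toℚ (μ nothing (1̂ n d 0<n d∣n)) ≡ 𝓔 d n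
  part-b 0<n = trans (part-c (osp (⊤ ∷ []) (top-isDivOSP 0<n d∣n)))
    (trans (ℚ.*-identityˡ _) (trans (ℚ.*-identityʳ _) (cong (𝓔 d) (∣⊤∣≡n n))))
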